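{- Let $n\ge1$, $A\ge 1$ be integers, and let $(n_{x,y})_{x,y\in[n]}$ be fixed nonnegative integers with $N=\sum_{x,y}n_{x,y}>0$. Define $\hat p_x=\sum_{y}n_{x,y}/N$, $\hat q_y=\sum_{x}n_{x,y}/N$, $\hat\Delta_{x,y}=n_{x,y}/N-\hat p_x\hat q_y$ and $\|\hat\Delta\|^2=\sum_{x,y\in[n]}\hat\Delta_{x,y}^2$. Let $h_1,h_2:[n]\to[A]$ be independent, uniformly random functions. For $a,b\in[A]$ let $C_{a,b}=\sum_{x\in h_1^{ -1}(a),\,y\in h_2^{ -1}(b)}n_{x,y}$ and $$\tilde\Delta_{a,b}=\frac{C_{a,b}}{N}-\frac{\big(\sum_{b'\in[A]}C_{a,b'}\big)\big(\sum_{a'\in[A]}C_{a',b}\big)}{N^2},\qquad \|\tilde\Delta\|^2=\sum_{a,b\in[A]}\tilde\Delta_{a,b}^2.$$ Then $\operatorname{Var}\big[\|\tilde\Delta\|^2\big]\le \frac{8}{A}\|\hat\Delta\|^4$ (variance over the random choice of $h_1,h_2$).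
   Context: $n_{x,y}$ is the number of times the pair $(x,y)$ appears in a stream of $N$ pairs from $[n]\times[n]$; $C$ is the $A\times A$ counter matrix obtained by incrementing $C_{h_1(x),h_2(y)}$ for each stream pair $(x,y)$. $[m]=\{1,\dots,m\}$. -}

module Defs where

open import Data.Nat using (ℕ; zero; suc)
import Data.Nat as ℕ
open import Data.Integer using (+_)
open import Data.Rational using (ℚ; 0ℚ; _+_; _*_; _-_; _/_)
open import Data.Fin using (Fin; zero; suc; _≟_)
open import Data.List using (List; []; _∷_; map; foldr; allFin; concatMap; length)
open import Data.Bool using (if_then_else_)
open import Relation.Nullary.Decidable using (⌊_⌋)

sumℚ : List ℚ → ℚ
sumℚ = foldr _+_ 0ℚ

Σℚ : (m : ℕ) → (Fin m → ℚ) → ℚ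
Σℚ m f = sumℚ (map f (allFin m))

Σℕ : (m : ℕ) → (Fin m → ℕ) → ℕ
Σℕ m f = foldr ℕ._+_ 0 (map f (allFin m))

-- k / d as a rational; (the d = 0 case is never used: N > 0 is a hypothesis)
_/ℕ_ : ℕ → ℕ → ℚ
k /ℕ zero = 0ℚ
k /ℕ suc d = (+ k) / suc d

mean : List ℚ → ℚ
mean [] = 0ℚ
mean (x ∷ xs) = sumℚ (x ∷ xs) /' suc (length xs)
  where
  _/'_ : ℚ → ℕ → ℚ
  q /' d = q * (1 /ℕ d)

-- the list of ALL functions [n] → [A] (each exactly once)
allFuns : (n A : ℕ) → List (Fin n → Fin A)
allFuns zero A = (λ ()) ∷ []
allFuns (suc n) A =
  concatMap (λ a → map (λ g → λ { zero → a ; (suc i) → g i }) (allFuns n A)) (allFin A)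

E₂ : (n A : ℕ) → ((Fin n → Fin A) → (Fin n → Fin A) → ℚ) → ℚ
E₂ n A X = mean (concatMap (λ h₁ → map (λ h₂ → X h₁ h₂) (allFuns n A)) (allFuns n A))

Var₂ : (n A : ℕ) → ((Fin n → Fin A) → (Fin n → Fin A) → ℚ) → ℚ
Var₂ n A X = E₂ n A (λ h₁ h₂ → X h₁ h₂ * X h₁ h₂) - (E₂ n A X * E₂ n A X)

Counts : ℕ → Set
Counts n = Fin n → Fin n → ℕ

total : (n : ℕ) → Counts n → ℕ
total n c = Σℕ n (λ x → Σℕ n (λ y → c x y))

Δhat : (n : ℕ) → Counts n → Fin n → Fin n → ℚ
Δhat n c x y = (c x y /ℕ N) - ((Σℕ n (λ y' → c x y') /ℕ N) * (Σℕ n (λ x' → c x' y) /ℕ N))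
  where N = total n c

normSqΔhat : (n : ℕ) → Counts n → ℚ
normSqΔhat n c = Σℚ n (λ x → Σℚ n (λ y → Δhat n c x y * Δhat n c x y))

Cmat : (n A : ℕ) → Counts n → (h₁ h₂ : Fin n → Fin A) → Fin A → Fin A → ℕ
Cmat n A c h₁ h₂ a b =
  Σℕ n (λ x → Σℕ n (λ y →
    if ⌊ h₁ x ≟ a ⌋ then (if ⌊ h₂ y ≟ b ⌋ then c x y else 0) else 0))

Δtilde : (n A : ℕ) → Counts n → (h₁ h₂ : Fin n → Fin A) → Fin A → Fin A → ℚ
Δtilde n A c h₁ h₂ a b =
  (C a b /ℕ N) - ((Σℕ A (λ b' → C a b') ℕ.* Σℕ A (λ a' → C a' b)) /ℕ (N ℕ.* N))
  where
  N = total n c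
  C = Cmat n A c h₁ h₂

normSqΔtilde : (n A : ℕ) → Counts n → (h₁ h₂ : Fin n → Fin A) → ℚ
normSqΔtilde n A c h₁ h₂ =
  Σℚ A (λ a → Σℚ A (λ b → Δtilde n A c h₁ h₂ a b * Δtilde n A c h₁ h₂ a b))

{-# OPTIONS --safe #-}
module Submission where

-- Write D = Δ̂. Its rows and columns sum to zero, and Δ̃ is D with the rows bucketed by h₁ and
-- the columns by h₂, so everything reduces to one random hash h : [n] → [A] applied to the
-- columns of a matrix M whose rows sum to zero. With G the Gram matrix of the columns of M,
-- ‖M bucketed by h‖² = Σ_{y,y′} [h y = h y′] G(y,y′). Split the indicator into its mean
-- u + (1 − u)[y = y′] (u = 1/A) and a fluctuation W. The mean part contributes (1 − u)‖M‖²
-- because G has zero row sums. W has mean zero, and E[W(y,y′) W(z,z′)] vanishes unless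
-- {z,z′} = {y,y′}: resampling h at a point lying in only one of the two pairs averages that
-- factor to zero. Hence E‖·‖⁴ ≤ (1 − u)²‖M‖⁴ + 2u(1 − u) Σ G(y,y′)² ≤ (1 − u²)‖M‖⁴ by
-- Cauchy–Schwarz, G(y,y′)² ≤ G(y,y) G(y′,y′). Applying this to h₂ and then to h₁ gives
-- E‖Δ̃‖² = (1 − u)²‖Δ̂‖² and E‖Δ̃‖⁴ ≤ (1 − u²)²‖Δ̂‖⁴, so the variance is at most
-- ((1 − u²)² − (1 − u)⁴)‖Δ̂‖⁴ = 4u(1 − u)²‖Δ̂‖⁴ ≤ 8u‖Δ̂‖⁴.

open import Defs
open import Data.Nat using (ℕ; _≤_; _<_)
open import Data.Rational using (ℚ; _*_) renaming (_≤_ to _≤ℚ_)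

open import Data.Nat as ℕ using (zero; suc; NonZero)
import Data.Nat.Properties as ℕ
import Data.Integer as ℤ
import Data.Integer.Properties as ℤ
open import Data.Rational using (0ℚ; 1ℚ; _+_; _-_; -_; _/_; toℚᵘ)
open import Data.Rational.Base using (nonNegative; nonPositive)
open import Data.Rational.Properties
  using (+-*-commutativeRing; +-*-ring; _≟_; toℚᵘ-injective; toℚᵘ-fromℚᵘ; toℚᵘ-homo-+; toℚᵘ-homo-*;
         ≤-refl; ≤-trans; ≤-reflexive; ≤-total; +-mono-≤; +-monoˡ-≤; +-monoʳ-≤; *-monoˡ-≤-nonNeg;
         *-monoʳ-≤-nonNeg; nonNegative⁻¹; normalize-nonNeg; nonNeg*nonNeg⇒nonNeg; nonPos*nonPos⇒nonPos;
         +-identityˡ; +-identityʳ; +-assoc; +-inverseʳ; *-zeroˡ; *-zeroʳ; *-identityˡ; *-identityʳ;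
         *-comm; *-assoc; *-distribˡ-+; *-distribʳ-+; module ≤-Reasoning)
import Data.Rational.Unnormalised as ℚᵘ
import Data.Rational.Unnormalised.Properties as ℚᵘ
open import Algebra.Bundles using (Ring)
open import Algebra.Properties.Semiring.Sum (Ring.semiring +-*-ring)
  using (sum; sum-syntax; sum-cong-≗; sum-replicate-zero; ∑-distrib-+; ∑-comm; *-distribˡ-sum; *-distribʳ-sum)
open import Data.Fin as Fin using (Fin; zero; suc)
open import Data.Bool using (true; false; if_then_else_)
open import Data.Sum using (inj₁; inj₂)
open import Data.Empty using (⊥-elim)
open import Data.List using (List; []; _∷_; _++_; map; concatMap; tabulate; length; allFin; foldr)
import Data.List.Properties as List
open import Data.Vec.Functional as Vector using (updateAt)
open import Data.Vec.Functional.Properties using (updateAt-updates; updateAt-minimal)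
open import Function using (_∘_; id; const; flip)
open import Relation.Nullary using (Dec; yes; no)
open import Relation.Nullary.Decidable using (⌊_⌋; dec⇒maybe)
open import Relation.Binary.PropositionalEquality
open import Tactic.RingSolver using (solve-∀)
import Tactic.RingSolver.Core.AlmostCommutativeRing as ACR

ℚ-ring : ACR.AlmostCommutativeRing _ _
ℚ-ring = ACR.fromCommutativeRing +-*-commutativeRing (λ x → dec⇒maybe (0ℚ ≟ x))

fromℕ : ℕ → ℚ
fromℕ k = ℤ.+ k / 1

-- ℚ is normalised by gcds, so identities between casts are checked on unnormalised representatives.
private
  toℚᵘ-/ : ∀ k d → toℚᵘ (ℤ.+ k / suc d) ℚᵘ.≃ ℚᵘ.mkℚᵘ (ℤ.+ k) d
  toℚᵘ-/ k d = toℚᵘ-fromℚᵘ (ℚᵘ.mkℚᵘ (ℤ.+ k) d)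

  ≡-viaℚᵘ : ∀ {p q p′ q′} → toℚᵘ p ℚᵘ.≃ p′ → toℚᵘ q ℚᵘ.≃ q′ → p′ ℚᵘ.≃ q′ → p ≡ q
  ≡-viaℚᵘ p≃p′ q≃q′ p′≃q′ = toℚᵘ-injective (ℚᵘ.≃-trans p≃p′ (ℚᵘ.≃-trans p′≃q′ (ℚᵘ.≃-sym q≃q′)))

  toℚᵘ-+ : ∀ {p q p′ q′} → toℚᵘ p ℚᵘ.≃ p′ → toℚᵘ q ℚᵘ.≃ q′ → toℚᵘ (p + q) ℚᵘ.≃ p′ ℚᵘ.+ q′
  toℚᵘ-+ {p} {q} p≃ q≃ = ℚᵘ.≃-trans (toℚᵘ-homo-+ p q) (ℚᵘ.+-cong p≃ q≃)

  toℚᵘ-* : ∀ {p q p′ q′} → toℚᵘ p ℚᵘ.≃ p′ → toℚᵘ q ℚᵘ.≃ q′ → toℚᵘ (p * q) ℚᵘ.≃ p′ ℚᵘ.* q′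
  toℚᵘ-* {p} {q} p≃ q≃ = ℚᵘ.≃-trans (toℚᵘ-homo-* p q) (ℚᵘ.*-cong p≃ q≃)

fromℕ-+ : ∀ a b → fromℕ (a ℕ.+ b) ≡ fromℕ a + fromℕ b
fromℕ-+ a b = ≡-viaℚᵘ (toℚᵘ-/ (a ℕ.+ b) 0) (toℚᵘ-+ (toℚᵘ-/ a 0) (toℚᵘ-/ b 0))
  (ℚᵘ.*≡* (cong (ℤ._* ℤ.+ 1) (trans (ℤ.pos-+ a b)
    (sym (cong₂ ℤ._+_ (ℤ.*-identityʳ (ℤ.+ a)) (ℤ.*-identityʳ (ℤ.+ b)))))))

fromℕ-* : ∀ a b → fromℕ (a ℕ.* b) ≡ fromℕ a * fromℕ b
fromℕ-* a b = ≡-viaℚᵘ (toℚᵘ-/ (a ℕ.* b) 0) (toℚᵘ-* (toℚᵘ-/ a 0) (toℚᵘ-/ b 0))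
  (ℚᵘ.*≡* (cong (ℤ._* ℤ.+ 1) (ℤ.pos-* a b)))

/ℕ-as-* : ∀ k N .{{_ : NonZero N}} → k /ℕ N ≡ fromℕ k * (1 /ℕ N)
/ℕ-as-* k (suc d) = ≡-viaℚᵘ (toℚᵘ-/ k d) (toℚᵘ-* (toℚᵘ-/ k 0) (toℚᵘ-/ 1 d))
  (ℚᵘ.*≡* (trans (cong (λ i → ℤ.+ k ℤ.* ℤ.+ i) (ℕ.*-identityˡ (suc d)))
                 (cong (ℤ._* ℤ.+ suc d) (sym (ℤ.*-identityʳ (ℤ.+ k))))))

fromℕ-*-1/ℕ : ∀ N .{{_ : NonZero N}} → fromℕ N * (1 /ℕ N) ≡ 1ℚ
fromℕ-*-1/ℕ (suc d) = ≡-viaℚᵘ (toℚᵘ-* (toℚᵘ-/ (suc d) 0) (toℚᵘ-/ 1 d)) (toℚᵘ-/ 1 0)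
  (ℚᵘ.*≡* (trans (ℤ.*-identityʳ _) (trans (ℤ.*-identityʳ _)
    (sym (trans (ℤ.*-identityˡ _) (cong ℤ.+_ (ℕ.*-identityˡ (suc d))))))))

1/ℕ-* : ∀ M N .{{_ : NonZero M}} .{{_ : NonZero N}} → 1 /ℕ (M ℕ.* N) ≡ (1 /ℕ M) * (1 /ℕ N)
1/ℕ-* (suc m) (suc n) = ≡-viaℚᵘ (toℚᵘ-/ 1 _) (toℚᵘ-* (toℚᵘ-/ 1 m) (toℚᵘ-/ 1 n)) (ℚᵘ.*≡* refl)

/ℕ-*-/ℕ : ∀ a b N .{{_ : NonZero N}} → (a ℕ.* b) /ℕ (N ℕ.* N) ≡ (a /ℕ N) * (b /ℕ N)
/ℕ-*-/ℕ a b N@(suc _) = begin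
  (a ℕ.* b) /ℕ (N ℕ.* N)                        ≡⟨ /ℕ-as-* (a ℕ.* b) (N ℕ.* N) ⟩
  fromℕ (a ℕ.* b) * (1 /ℕ (N ℕ.* N))            ≡⟨ cong₂ _*_ (fromℕ-* a b) (1/ℕ-* N N) ⟩
  fromℕ a * fromℕ b * ((1 /ℕ N) * (1 /ℕ N))     ≡⟨ interchange (fromℕ a) (fromℕ b) (1 /ℕ N) (1 /ℕ N) ⟩
  fromℕ a * (1 /ℕ N) * (fromℕ b * (1 /ℕ N))     ≡⟨ cong₂ _*_ (/ℕ-as-* a N) (/ℕ-as-* b N) ⟨
  (a /ℕ N) * (b /ℕ N)                           ∎
  where
  open ≡-Reasoning
  interchange : ∀ w x y z → w * x * (y * z) ≡ w * y * (x * z)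
  interchange = solve-∀ ℚ-ring

0≤fromℕ : ∀ k → 0ℚ ≤ℚ fromℕ k
0≤fromℕ k = nonNegative⁻¹ (fromℕ k) {{normalize-nonNeg k 1}}

0≤1/ℕ : ∀ N .{{_ : NonZero N}} → 0ℚ ≤ℚ 1 /ℕ N
0≤1/ℕ (suc d) = nonNegative⁻¹ (1 /ℕ suc d) {{normalize-nonNeg 1 (suc d)}}

0≤+ : ∀ {p q} → 0ℚ ≤ℚ p → 0ℚ ≤ℚ q → 0ℚ ≤ℚ p + q
0≤+ = +-mono-≤

0≤* : ∀ {p q} → 0ℚ ≤ℚ p → 0ℚ ≤ℚ q → 0ℚ ≤ℚ p * q
0≤* {p} {q} 0≤p 0≤q =
  nonNegative⁻¹ (p * q) {{nonNeg*nonNeg⇒nonNeg p {{nonNegative 0≤p}} q {{nonNegative 0≤q}}}}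

0≤*-self : ∀ p → 0ℚ ≤ℚ p * p
0≤*-self p with ≤-total 0ℚ p
... | inj₁ 0≤p = 0≤* 0≤p 0≤p
... | inj₂ p≤0 = nonNegative⁻¹ (p * p) {{nonPos*nonPos⇒nonPos p {{nonPositive p≤0}} p {{nonPositive p≤0}}}}

*-monoˡ-≤ : ∀ {r p q} → 0ℚ ≤ℚ r → p ≤ℚ q → r * p ≤ℚ r * q
*-monoˡ-≤ {r} 0≤r = *-monoˡ-≤-nonNeg r {{nonNegative 0≤r}}

0≤q-p⇒p≤q : ∀ {p q} → 0ℚ ≤ℚ q - p → p ≤ℚ q
0≤q-p⇒p≤q {p} {q} 0≤q-p = subst₂ _≤ℚ_ (+-identityˡ p) (right p q) (+-mono-≤ 0≤q-p (≤-refl {p}))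
  where
  right : ∀ p q → q - p + p ≡ q
  right = solve-∀ ℚ-ring

0≤1-1/ℕ : ∀ A .{{_ : NonZero A}} → 0ℚ ≤ℚ 1ℚ - 1 /ℕ A
0≤1-1/ℕ A@(suc A′) = subst (0ℚ ≤ℚ_) eq (0≤* (0≤fromℕ A′) (0≤1/ℕ A))
  where
  open ≡-Reasoning
  shift : ∀ a u → (1ℚ + a) * u - u ≡ a * u
  shift = solve-∀ ℚ-ring
  eq : fromℕ A′ * (1 /ℕ A) ≡ 1ℚ - 1 /ℕ A
  eq = begin
    fromℕ A′ * (1 /ℕ A)                     ≡⟨ shift (fromℕ A′) (1 /ℕ A) ⟨
    (1ℚ + fromℕ A′) * (1 /ℕ A) - 1 /ℕ A     ≡⟨ cong (λ a → a * (1 /ℕ A) - 1 /ℕ A) (fromℕ-+ 1 A′) ⟨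
    fromℕ A * (1 /ℕ A) - 1 /ℕ A             ≡⟨ cong (_- 1 /ℕ A) (fromℕ-*-1/ℕ A) ⟩
    1ℚ - 1 /ℕ A                             ∎

∑-distrib-minus : ∀ {m} (f g : Fin m → ℚ) → ∑[ i < m ] (f i - g i) ≡ sum f - sum g
∑-distrib-minus {zero}  f g = refl
∑-distrib-minus {suc m} f g = trans (cong ((f zero - g zero) +_) (∑-distrib-minus (f ∘ suc) (g ∘ suc)))
  (regroup (f zero) (g zero) _ _)
  where
  regroup : ∀ a b c d → a - b + (c - d) ≡ a + c - (b + d)
  regroup = solve-∀ ℚ-ring

fromℕ-suc-* : ∀ m c → c + fromℕ m * c ≡ fromℕ (suc m) * c
fromℕ-suc-* m c = trans (step c (fromℕ m)) (cong (_* c) (sym (fromℕ-+ 1 m)))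
  where
  step : ∀ c x → c + x * c ≡ (1ℚ + x) * c
  step = solve-∀ ℚ-ring

∑-const : ∀ m c → ∑[ i < m ] c ≡ fromℕ m * c
∑-const zero    c = sym (*-zeroˡ c)
∑-const (suc m) c = trans (cong (c +_) (∑-const m c)) (fromℕ-suc-* m c)

∑-mono-≤ : ∀ {m} {f g : Fin m → ℚ} → (∀ i → f i ≤ℚ g i) → sum f ≤ℚ sum g
∑-mono-≤ {zero}  f≤g = ≤-refl
∑-mono-≤ {suc m} f≤g = +-mono-≤ (f≤g zero) (∑-mono-≤ (f≤g ∘ suc))

0≤∑ : ∀ {m} {f : Fin m → ℚ} → (∀ i → 0ℚ ≤ℚ f i) → 0ℚ ≤ℚ sum f
0≤∑ {m} 0≤f = ≤-trans (≤-reflexive (sym (sum-replicate-zero m))) (∑-mono-≤ 0≤f)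

∑-*-∑ : ∀ {m k} (f : Fin m → ℚ) (g : Fin k → ℚ) → sum f * sum g ≡ ∑[ i < m ] ∑[ j < k ] (f i * g j)
∑-*-∑ f g = trans (*-distribʳ-sum (sum g) f) (sum-cong-≗ (λ i → *-distribˡ-sum (f i) g))

∑-comm₃ : ∀ {m k l} (f : Fin m → Fin k → Fin l → ℚ) →
          ∑[ i < m ] ∑[ j < k ] ∑[ r < l ] f i j r ≡ ∑[ j < k ] ∑[ r < l ] ∑[ i < m ] f i j r
∑-comm₃ {m} {k} {l} f = trans (∑-comm (λ i j → ∑[ r < l ] f i j r))
                              (sum-cong-≗ (λ j → ∑-comm (λ i r → f i j r)))

∑∑-*-∑∑ : ∀ {m k} (f : Fin m → Fin m → ℚ) (g : Fin k → Fin k → ℚ) →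
  ∑[ y < m ] ∑[ y′ < m ] f y y′ * ∑[ z < k ] ∑[ z′ < k ] g z z′
  ≡ ∑[ y < m ] ∑[ y′ < m ] ∑[ z < k ] ∑[ z′ < k ] (f y y′ * g z z′)
∑∑-*-∑∑ {m} {k} f g = trans (∑-*-∑ (λ y → ∑[ y′ < m ] f y y′) (λ z → ∑[ z′ < k ] g z z′))
  (sum-cong-≗ λ y → trans (sum-cong-≗ λ z → ∑-*-∑ (f y) (g z))
                          (∑-comm (λ z y′ → ∑[ z′ < k ] (f y y′ * g z z′))))

*-distribˡ-∑∑ : ∀ {m k} x (f : Fin m → Fin k → ℚ) →
                x * ∑[ i < m ] ∑[ j < k ] f i j ≡ ∑[ i < m ] ∑[ j < k ] (x * f i j)
*-distribˡ-∑∑ {m} {k} x f = trans (*-distribˡ-sum x (λ i → ∑[ j < k ] f i j))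
                                  (sum-cong-≗ (λ i → *-distribˡ-sum x (f i)))

δ : ∀ {m} → Fin m → Fin m → ℚ
δ i j = if ⌊ i Fin.≟ j ⌋ then 1ℚ else 0ℚ

δ-suc : ∀ {m} (i j : Fin m) → δ (suc i) (suc j) ≡ δ i j
δ-suc i j with i Fin.≟ j
... | yes _ = refl
... | no  _ = refl

δ-refl : ∀ {m} (i : Fin m) → δ i i ≡ 1ℚ
δ-refl i with i Fin.≟ i
... | yes _   = refl
... | no  i≢i = ⊥-elim (i≢i refl)

δ-≢ : ∀ {m} {i j : Fin m} → i ≢ j → δ i j ≡ 0ℚ
δ-≢ {i = i} {j} i≢j with i Fin.≟ j
... | yes i≡j = ⊥-elim (i≢j i≡j)
... | no  _   = refl

δ-sym : ∀ {m} (i j : Fin m) → δ i j ≡ δ j i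
δ-sym i j with i Fin.≟ j | j Fin.≟ i
... | yes _   | yes _   = refl
... | no  _   | no  _   = refl
... | yes i≡j | no  j≢i = ⊥-elim (j≢i (sym i≡j))
... | no  i≢j | yes j≡i = ⊥-elim (i≢j (sym j≡i))

δ-idem : ∀ {m} (i j : Fin m) → δ i j * δ i j ≡ δ i j
δ-idem i j with i Fin.≟ j
... | yes _ = refl
... | no  _ = refl

∑-δ-* : ∀ {m} (i : Fin m) (f : Fin m → ℚ) → ∑[ j < m ] (δ i j * f j) ≡ f i
∑-δ-* {suc m} zero f = trans (cong (1ℚ * f zero +_) rest) (unit (f zero))
  where
  rest : ∑[ j < m ] (δ zero (suc j) * f (suc j)) ≡ 0ℚ
  rest = trans (sum-cong-≗ (λ j → *-zeroˡ (f (suc j)))) (sum-replicate-zero m)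
  unit : ∀ x → 1ℚ * x + 0ℚ ≡ x
  unit = solve-∀ ℚ-ring
∑-δ-* {suc m} (suc i) f = trans (cong (0ℚ * f zero +_) (trans
  (sum-cong-≗ (λ j → cong (_* f (suc j)) (δ-suc i j))) (∑-δ-* i (f ∘ suc)))) (absorb (f zero) (f (suc i)))
  where
  absorb : ∀ x y → 0ℚ * x + y ≡ y
  absorb = solve-∀ ℚ-ring

∑-δ : ∀ {m} (i : Fin m) → ∑[ j < m ] δ i j ≡ 1ℚ
∑-δ {m} i = trans (sum-cong-≗ (λ j → sym (*-identityʳ (δ i j)))) (∑-δ-* i (λ _ → 1ℚ))

cauchy-schwarz : ∀ {m} (a b : Fin m → ℚ) →
  ∑[ i < m ] (a i * b i) * ∑[ i < m ] (a i * b i) ≤ℚ ∑[ i < m ] (a i * a i) * ∑[ i < m ] (b i * b i)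
cauchy-schwarz {m} a b = 0≤q-p⇒p≤q (subst (0ℚ ≤ℚ_) lagrange
  (0≤* (0≤1/ℕ 2) (0≤∑ (λ i → 0≤∑ (λ j → 0≤*-self (a i * b j - a j * b i))))))
  where
  open ≡-Reasoning
  Saa = ∑[ i < m ] (a i * a i)
  Sbb = ∑[ i < m ] (b i * b i)
  Sab = ∑[ i < m ] (a i * b i)
  expand : ∀ ai aj bi bj → (ai * bj - aj * bi) * (ai * bj - aj * bi)
         ≡ (ai * ai) * (bj * bj) + (bi * bi) * (aj * aj) - ((ai * bi) * (aj * bj) + (ai * bi) * (aj * bj))
  expand = solve-∀ ℚ-ring
  halve : ∀ x y z → 1 /ℕ 2 * (x * y + y * x - (z * z + z * z)) ≡ x * y - z * z
  halve = solve-∀ ℚ-ring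
  ∑∑-split : ∀ (f g f′ g′ e : Fin m → ℚ) →
    ∑[ i < m ] ∑[ j < m ] (f i * g j + f′ i * g′ j - (e i * e j + e i * e j))
    ≡ sum f * sum g + sum f′ * sum g′ - (sum e * sum e + sum e * sum e)
  ∑∑-split f g f′ g′ e = begin
    ∑[ i < m ] ∑[ j < m ] (f i * g j + f′ i * g′ j - (e i * e j + e i * e j))
      ≡⟨ sum-cong-≗ (λ i → trans (∑-distrib-minus (λ j → f i * g j + f′ i * g′ j) (λ j → e i * e j + e i * e j))
           (cong₂ _-_ (∑-distrib-+ (λ j → f i * g j) (λ j → f′ i * g′ j))
                      (∑-distrib-+ (λ j → e i * e j) (λ j → e i * e j)))) ⟩
    ∑[ i < m ] (∑[ j < m ] (f i * g j) + ∑[ j < m ] (f′ i * g′ j)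
                - (∑[ j < m ] (e i * e j) + ∑[ j < m ] (e i * e j)))
      ≡⟨ trans (∑-distrib-minus _ (λ i → ∑[ j < m ] (e i * e j) + ∑[ j < m ] (e i * e j)))
           (cong₂ _-_ (∑-distrib-+ (λ i → ∑[ j < m ] (f i * g j)) (λ i → ∑[ j < m ] (f′ i * g′ j)))
                      (∑-distrib-+ (λ i → ∑[ j < m ] (e i * e j)) (λ i → ∑[ j < m ] (e i * e j)))) ⟩
    ∑[ i < m ] ∑[ j < m ] (f i * g j) + ∑[ i < m ] ∑[ j < m ] (f′ i * g′ j)
      - (∑[ i < m ] ∑[ j < m ] (e i * e j) + ∑[ i < m ] ∑[ j < m ] (e i * e j))
      ≡⟨ cong₂ _-_ (cong₂ _+_ (∑-*-∑ f g) (∑-*-∑ f′ g′)) (cong₂ _+_ (∑-*-∑ e e) (∑-*-∑ e e)) ⟨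
    sum f * sum g + sum f′ * sum g′ - (sum e * sum e + sum e * sum e) ∎
  lagrange : 1 /ℕ 2 * ∑[ i < m ] ∑[ j < m ] ((a i * b j - a j * b i) * (a i * b j - a j * b i))
           ≡ Saa * Sbb - Sab * Sab
  lagrange = begin
    1 /ℕ 2 * ∑[ i < m ] ∑[ j < m ] ((a i * b j - a j * b i) * (a i * b j - a j * b i))
      ≡⟨ cong (1 /ℕ 2 *_) (sum-cong-≗ (λ i → sum-cong-≗ (λ j → expand (a i) (a j) (b i) (b j)))) ⟩
    1 /ℕ 2 * ∑[ i < m ] ∑[ j < m ] ((a i * a i) * (b j * b j) + (b i * b i) * (a j * a j)
                                    - ((a i * b i) * (a j * b j) + (a i * b i) * (a j * b j)))
      ≡⟨ cong (1 /ℕ 2 *_) (∑∑-split _ _ _ _ _) ⟩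
    1 /ℕ 2 * (Saa * Sbb + Sbb * Saa - (Sab * Sab + Sab * Sab))
      ≡⟨ halve Saa Sbb Sab ⟩
    Saa * Sbb - Sab * Sab ∎

sumℚ-tabulate : ∀ {m} (f : Fin m → ℚ) → sumℚ (tabulate f) ≡ sum f
sumℚ-tabulate {zero}  f = refl
sumℚ-tabulate {suc m} f = cong (f zero +_) (sumℚ-tabulate (f ∘ suc))

Σℚ≡∑ : ∀ m (f : Fin m → ℚ) → Σℚ m f ≡ sum f
Σℚ≡∑ m f = trans (cong sumℚ (List.map-tabulate id f)) (sumℚ-tabulate f)

fromℕ-Σℕ : ∀ m (f : Fin m → ℕ) → fromℕ (Σℕ m f) ≡ ∑[ i < m ] fromℕ (f i)
fromℕ-Σℕ m f = trans (cong (fromℕ ∘ foldr ℕ._+_ 0) (List.map-tabulate id f)) (go f)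
  where
  go : ∀ {k} (g : Fin k → ℕ) → fromℕ (foldr ℕ._+_ 0 (tabulate g)) ≡ ∑[ i < k ] fromℕ (g i)
  go {zero}  g = refl
  go {suc k} g = trans (fromℕ-+ (g zero) _) (cong (fromℕ (g zero) +_) (go (g ∘ suc)))

sumOver : ∀ {X : Set} → List X → (X → ℚ) → ℚ
sumOver xs F = sumℚ (map F xs)

module _ {X : Set} where

  sumOver-cong : ∀ (xs : List X) {F G : X → ℚ} → (∀ x → F x ≡ G x) → sumOver xs F ≡ sumOver xs G
  sumOver-cong []       F≗G = refl
  sumOver-cong (x ∷ xs) F≗G = cong₂ _+_ (F≗G x) (sumOver-cong xs F≗G)

  sumOver-+ : ∀ (xs : List X) (F G : X → ℚ) → sumOver xs (λ x → F x + G x) ≡ sumOver xs F + sumOver xs G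
  sumOver-+ []       F G = refl
  sumOver-+ (x ∷ xs) F G = trans (cong (F x + G x +_) (sumOver-+ xs F G)) (regroup (F x) (G x) _ _)
    where
    regroup : ∀ a b c d → a + b + (c + d) ≡ a + c + (b + d)
    regroup = solve-∀ ℚ-ring

  sumOver-*ˡ : ∀ (xs : List X) c (F : X → ℚ) → sumOver xs (λ x → c * F x) ≡ c * sumOver xs F
  sumOver-*ˡ []       c F = sym (*-zeroʳ c)
  sumOver-*ˡ (x ∷ xs) c F = trans (cong (c * F x +_) (sumOver-*ˡ xs c F)) (distrib c (F x) _)
    where
    distrib : ∀ c a b → c * a + c * b ≡ c * (a + b)
    distrib = solve-∀ ℚ-ring

  sumOver-*ʳ : ∀ (xs : List X) c (F : X → ℚ) → sumOver xs (λ x → F x * c) ≡ sumOver xs F * c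
  sumOver-*ʳ xs c F = trans (sumOver-cong xs (λ x → *-comm (F x) c))
                            (trans (sumOver-*ˡ xs c F) (*-comm c _))

  sumOver-const : ∀ (xs : List X) c → sumOver xs (λ _ → c) ≡ fromℕ (length xs) * c
  sumOver-const []       c = sym (*-zeroˡ c)
  sumOver-const (x ∷ xs) c = trans (cong (c +_) (sumOver-const xs c)) (fromℕ-suc-* (length xs) c)

  sumOver-mono-≤ : ∀ (xs : List X) {F G : X → ℚ} → (∀ x → F x ≤ℚ G x) → sumOver xs F ≤ℚ sumOver xs G
  sumOver-mono-≤ []       F≤G = ≤-refl
  sumOver-mono-≤ (x ∷ xs) F≤G = +-mono-≤ (F≤G x) (sumOver-mono-≤ xs F≤G)

  sumOver-∑ : ∀ (xs : List X) m (F : X → Fin m → ℚ) →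
              sumOver xs (λ x → ∑[ i < m ] F x i) ≡ ∑[ i < m ] sumOver xs (λ x → F x i)
  sumOver-∑ []       m F = sym (sum-replicate-zero m)
  sumOver-∑ (x ∷ xs) m F = trans (cong (sum (F x) +_) (sumOver-∑ xs m F))
                                 (sym (∑-distrib-+ (F x) (λ i → sumOver xs (λ y → F y i))))

  sumOver-++ : ∀ (xs ys : List X) (F : X → ℚ) → sumOver (xs ++ ys) F ≡ sumOver xs F + sumOver ys F
  sumOver-++ []       ys F = sym (+-identityˡ _)
  sumOver-++ (x ∷ xs) ys F = trans (cong (F x +_) (sumOver-++ xs ys F)) (sym (+-assoc (F x) _ _))

sumOver-concatMap : ∀ {X Y : Set} (g : Y → List X) (ys : List Y) (F : X → ℚ) →
                    sumOver (concatMap g ys) F ≡ sumOver ys (λ y → sumOver (g y) F)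
sumOver-concatMap g []       F = refl
sumOver-concatMap g (y ∷ ys) F =
  trans (sumOver-++ (g y) (concatMap g ys) F) (cong (sumOver (g y) F +_) (sumOver-concatMap g ys F))

sumOver-map : ∀ {X Y : Set} (k : Y → X) (ys : List Y) (F : X → ℚ) → sumOver (map k ys) F ≡ sumOver ys (F ∘ k)
sumOver-map k ys F = cong sumℚ (sym (List.map-∘ ys))

-- Uniformly random functions

_[_]≔_ : ∀ {n A} → (Fin n → Fin A) → Fin n → Fin A → Fin n → Fin A
h [ x ]≔ a = updateAt h x (const a)

[]≔-cong : ∀ {n A} {h h′ : Fin n → Fin A} x a → h ≗ h′ → h [ x ]≔ a ≗ h′ [ x ]≔ a
[]≔-cong {h = h} {h′} x a h≗h′ i with i Fin.≟ x
... | yes refl = trans (updateAt-updates i h) (sym (updateAt-updates i h′))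
... | no  i≢x  = trans (updateAt-minimal i x h i≢x) (trans (h≗h′ i) (sym (updateAt-minimal i x h′ i≢x)))

[]≔-here : ∀ {n A} (h : Fin n → Fin A) x a → (h [ x ]≔ a) x ≡ a
[]≔-here h x a = updateAt-updates x h

[]≔-away : ∀ {n A} (h : Fin n → Fin A) {x z} a → z ≢ x → (h [ x ]≔ a) z ≡ h z
[]≔-away h {x} {z} a z≢x = updateAt-minimal z x h z≢x

Extensional : ∀ {n A} → ((Fin n → Fin A) → ℚ) → Set
Extensional F = ∀ {h h′} → h ≗ h′ → F h ≡ F h′

sumFuns : ∀ n A → ((Fin n → Fin A) → ℚ) → ℚ
sumFuns n A = sumOver (allFuns n A)

sumFuns-suc : ∀ n A (F : (Fin (suc n) → Fin A) → ℚ) → Extensional F →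
              sumFuns (suc n) A F ≡ ∑[ a < A ] sumFuns n A (λ g → F (a Vector.∷ g))
sumFuns-suc n A F F-ext =
  trans (sumOver-concatMap _ (allFin A) F) (trans (Σℚ≡∑ A _) (sum-cong-≗ λ a →
    trans (sumOver-map _ (allFuns n A) F) (sumOver-cong (allFuns n A) λ g →
      F-ext {h′ = a Vector.∷ g} λ { zero → refl ; (suc i) → refl })))

sumFuns-resample : ∀ n A (x : Fin n) (F : (Fin n → Fin A) → ℚ) → Extensional F →
                   fromℕ A * sumFuns n A F ≡ sumFuns n A (λ h → ∑[ a < A ] F (h [ x ]≔ a))
sumFuns-resample (suc n) A zero F F-ext = sym (begin
  sumFuns (suc n) A (λ h → ∑[ a < A ] F (h [ zero ]≔ a))
    ≡⟨ sumFuns-suc n A _ (λ h≗h′ → sum-cong-≗ (λ a → F-ext ([]≔-cong zero a h≗h′))) ⟩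
  ∑[ b < A ] sumFuns n A (λ g → ∑[ a < A ] F ((b Vector.∷ g) [ zero ]≔ a))
    ≡⟨ sum-cong-≗ (λ b → sumOver-cong (allFuns n A) (λ g → sum-cong-≗ (λ a →
         F-ext {(b Vector.∷ g) [ zero ]≔ a} {a Vector.∷ g} λ { zero → refl ; (suc i) → refl }))) ⟩
  ∑[ b < A ] sumFuns n A (λ g → ∑[ a < A ] F (a Vector.∷ g))
    ≡⟨ ∑-const A _ ⟩
  fromℕ A * sumFuns n A (λ g → ∑[ a < A ] F (a Vector.∷ g))
    ≡⟨ cong (fromℕ A *_) (sumOver-∑ (allFuns n A) A (λ g a → F (a Vector.∷ g))) ⟩
  fromℕ A * ∑[ a < A ] sumFuns n A (λ g → F (a Vector.∷ g))
    ≡⟨ cong (fromℕ A *_) (sumFuns-suc n A F F-ext) ⟨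
  fromℕ A * sumFuns (suc n) A F ∎)
  where open ≡-Reasoning
sumFuns-resample (suc n) A (suc x) F F-ext = sym (begin
  sumFuns (suc n) A (λ h → ∑[ a < A ] F (h [ suc x ]≔ a))
    ≡⟨ sumFuns-suc n A _ (λ h≗h′ → sum-cong-≗ (λ a → F-ext ([]≔-cong (suc x) a h≗h′))) ⟩
  ∑[ b < A ] sumFuns n A (λ g → ∑[ a < A ] F ((b Vector.∷ g) [ suc x ]≔ a))
    ≡⟨ sum-cong-≗ (λ b → sumOver-cong (allFuns n A) (λ g → sum-cong-≗ (λ a →
         F-ext {(b Vector.∷ g) [ suc x ]≔ a} {b Vector.∷ (g [ x ]≔ a)} λ { zero → refl ; (suc i) → refl }))) ⟩
  ∑[ b < A ] sumFuns n A (λ g → ∑[ a < A ] F (b Vector.∷ (g [ x ]≔ a)))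
    ≡⟨ sum-cong-≗ (λ b → sym (sumFuns-resample n A x (λ g → F (b Vector.∷ g))
         (λ g≗g′ → F-ext λ { zero → refl ; (suc i) → g≗g′ i }))) ⟩
  ∑[ b < A ] (fromℕ A * sumFuns n A (λ g → F (b Vector.∷ g)))
    ≡⟨ *-distribˡ-sum (fromℕ A) (λ b → sumFuns n A (λ g → F (b Vector.∷ g))) ⟨
  fromℕ A * ∑[ b < A ] sumFuns n A (λ g → F (b Vector.∷ g))
    ≡⟨ cong (fromℕ A *_) (sumFuns-suc n A F F-ext) ⟨
  fromℕ A * sumFuns (suc n) A F ∎)
  where open ≡-Reasoning

length-concatMap-map : ∀ {X Y Z : Set} (k : Y → X → Z) (xs : List X) (ys : List Y) →
                       length (concatMap (λ y → map (k y) xs) ys) ≡ length ys ℕ.* length xs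
length-concatMap-map k xs []       = refl
length-concatMap-map k xs (y ∷ ys) = trans (List.length-++ (map (k y) xs))
  (cong₂ ℕ._+_ (List.length-map (k y) xs) (length-concatMap-map k xs ys))

length-allFuns : ∀ n A → length (allFuns n A) ≡ A ℕ.^ n
length-allFuns zero    A = refl
length-allFuns (suc n) A = trans (length-concatMap-map _ (allFuns n A) (allFin A))
  (cong₂ ℕ._*_ (List.length-tabulate {n = A} id) (length-allFuns n A))

-- Opaque, so that unification sees 𝔼 F rather than its unfolding; 𝔼-unfold gives the definition.
opaque
  𝔼 : ∀ {n A} → ((Fin n → Fin A) → ℚ) → ℚ
  𝔼 {n} {A} F = sumFuns n A F * (1 /ℕ (A ℕ.^ n))

module _ {n A : ℕ} .{{_ : NonZero A}} where

  private instance
    A^n≢0 : NonZero (A ℕ.^ n)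
    A^n≢0 = ℕ.m^n≢0 A n

  opaque
    unfolding 𝔼

    𝔼-unfold : ∀ (F : (Fin n → Fin A) → ℚ) → 𝔼 F ≡ sumFuns n A F * (1 /ℕ (A ℕ.^ n))
    𝔼-unfold F = refl

    𝔼-cong : ∀ {F G : (Fin n → Fin A) → ℚ} → (∀ h → F h ≡ G h) → 𝔼 F ≡ 𝔼 G
    𝔼-cong F≗G = cong (_* _) (sumOver-cong (allFuns n A) F≗G)

    𝔼-+ : ∀ (F G : (Fin n → Fin A) → ℚ) → 𝔼 (λ h → F h + G h) ≡ 𝔼 F + 𝔼 G
    𝔼-+ F G = trans (cong (_* _) (sumOver-+ (allFuns n A) F G))
                    (*-distribʳ-+ (1 /ℕ (A ℕ.^ n)) (sumFuns n A F) (sumFuns n A G))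

    𝔼-*ˡ : ∀ c (F : (Fin n → Fin A) → ℚ) → 𝔼 (λ h → c * F h) ≡ c * 𝔼 F
    𝔼-*ˡ c F = trans (cong (_* _) (sumOver-*ˡ (allFuns n A) c F)) (*-assoc c _ _)

    𝔼-const : ∀ c → 𝔼 {n} {A} (λ _ → c) ≡ c
    𝔼-const c = begin
      sumOver (allFuns n A) (λ _ → c) * (1 /ℕ (A ℕ.^ n))   ≡⟨ cong (_* _) (sumOver-const (allFuns n A) c) ⟩
      fromℕ (length (allFuns n A)) * c * (1 /ℕ (A ℕ.^ n))
        ≡⟨ cong (λ k → fromℕ k * c * (1 /ℕ (A ℕ.^ n))) (length-allFuns n A) ⟩
      fromℕ (A ℕ.^ n) * c * (1 /ℕ (A ℕ.^ n))               ≡⟨ swap (fromℕ (A ℕ.^ n)) c _ ⟩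
      c * (fromℕ (A ℕ.^ n) * (1 /ℕ (A ℕ.^ n)))             ≡⟨ cong (c *_) (fromℕ-*-1/ℕ (A ℕ.^ n)) ⟩
      c * 1ℚ                                               ≡⟨ *-identityʳ c ⟩
      c                                                    ∎
      where
      open ≡-Reasoning
      swap : ∀ k c r → k * c * r ≡ c * (k * r)
      swap = solve-∀ ℚ-ring

    𝔼-mono-≤ : ∀ {F G : (Fin n → Fin A) → ℚ} → (∀ h → F h ≤ℚ G h) → 𝔼 F ≤ℚ 𝔼 G
    𝔼-mono-≤ F≤G = *-monoʳ-≤-nonNeg _ {{nonNegative (0≤1/ℕ (A ℕ.^ n))}} (sumOver-mono-≤ (allFuns n A) F≤G)

    𝔼-∑ : ∀ m (F : (Fin n → Fin A) → Fin m → ℚ) → 𝔼 (λ h → ∑[ i < m ] F h i) ≡ ∑[ i < m ] 𝔼 (λ h → F h i)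
    𝔼-∑ m F = trans (cong (_* _) (sumOver-∑ (allFuns n A) m F)) (*-distribʳ-sum _ (λ i → sumFuns n A (λ h → F h i)))

    𝔼-resample : ∀ (x : Fin n) (F : (Fin n → Fin A) → ℚ) → Extensional F →
                 𝔼 F ≡ 𝔼 (λ h → 1 /ℕ A * ∑[ a < A ] F (h [ x ]≔ a))
    𝔼-resample x F F-ext = begin
      sumFuns n A F * r                                       ≡⟨ cong (_* r) (rescale (sumFuns n A F)) ⟩
      1 /ℕ A * (fromℕ A * sumFuns n A F) * r                  ≡⟨ cong (λ s → 1 /ℕ A * s * r) (sumFuns-resample n A x F F-ext) ⟩
      1 /ℕ A * sumFuns n A (λ h → ∑[ a < A ] F (h [ x ]≔ a)) * r  ≡⟨ *-assoc (1 /ℕ A) _ r ⟩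
      1 /ℕ A * 𝔼 (λ h → ∑[ a < A ] F (h [ x ]≔ a))              ≡⟨ 𝔼-*ˡ (1 /ℕ A) _ ⟨
      𝔼 (λ h → 1 /ℕ A * ∑[ a < A ] F (h [ x ]≔ a))              ∎
      where
      open ≡-Reasoning
      r : ℚ
      r = 1 /ℕ (A ℕ.^ n)
      rescale : ∀ s → s ≡ 1 /ℕ A * (fromℕ A * s)
      rescale s = begin
        s                          ≡⟨ *-identityˡ s ⟨
        1ℚ * s                     ≡⟨ cong (_* s) (fromℕ-*-1/ℕ A) ⟨
        fromℕ A * (1 /ℕ A) * s     ≡⟨ reassoc (fromℕ A) (1 /ℕ A) s ⟩
        1 /ℕ A * (fromℕ A * s)     ∎
        where
        reassoc : ∀ a b s → a * b * s ≡ b * (a * s)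
        reassoc = solve-∀ ℚ-ring

  E₂≡𝔼𝔼 : ∀ (X : (Fin n → Fin A) → (Fin n → Fin A) → ℚ) → E₂ n A X ≡ 𝔼 (λ h₁ → 𝔼 (λ h₂ → X h₁ h₂))
  E₂≡𝔼𝔼 X = begin
    mean pairs
      ≡⟨ mean-as-* pairs ⟩
    sumℚ pairs * (1 /ℕ length pairs)
      ≡⟨ cong₂ (λ s k → s * (1 /ℕ k)) sum-pairs
           (trans (length-concatMap-map X L L) (cong (λ k → k ℕ.* k) (length-allFuns n A))) ⟩
    sumOver L (λ h₁ → sumOver L (X h₁)) * (1 /ℕ (A ℕ.^ n ℕ.* A ℕ.^ n))
      ≡⟨ cong (sumOver L (λ h₁ → sumOver L (X h₁)) *_) (1/ℕ-* (A ℕ.^ n) (A ℕ.^ n)) ⟩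
    sumOver L (λ h₁ → sumOver L (X h₁)) * (r * r)
      ≡⟨ *-assoc (sumOver L (λ h₁ → sumOver L (X h₁))) r r ⟨
    sumOver L (λ h₁ → sumOver L (X h₁)) * r * r
      ≡⟨ cong (_* r) (sumOver-*ʳ L r (λ h₁ → sumOver L (X h₁))) ⟨
    sumOver L (λ h₁ → sumOver L (X h₁) * r) * r
      ≡⟨ cong (_* r) (sumOver-cong L (λ h₁ → 𝔼-unfold (X h₁))) ⟨
    sumOver L (λ h₁ → 𝔼 (X h₁)) * r
      ≡⟨ 𝔼-unfold (λ h₁ → 𝔼 (X h₁)) ⟨
    𝔼 (λ h₁ → 𝔼 (λ h₂ → X h₁ h₂)) ∎
    where
    open ≡-Reasoning
    L = allFuns n A
    r = 1 /ℕ (A ℕ.^ n)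
    pairs = concatMap (λ h₁ → map (X h₁) L) L
    mean-as-* : ∀ xs → mean xs ≡ sumℚ xs * (1 /ℕ length xs)
    mean-as-* []       = refl  -- 1 /ℕ 0 is 0ℚ
    mean-as-* (x ∷ xs) = refl
    sum-pairs : sumℚ pairs ≡ sumOver L (λ h₁ → sumOver L (X h₁))
    sum-pairs = begin
      sumℚ pairs                                   ≡⟨ cong sumℚ (List.map-id pairs) ⟨
      sumOver pairs id                             ≡⟨ sumOver-concatMap (λ h₁ → map (X h₁) L) L id ⟩
      sumOver L (λ h₁ → sumOver (map (X h₁) L) id) ≡⟨ sumOver-cong L (λ h₁ → sumOver-map (X h₁) L id) ⟩
      sumOver L (λ h₁ → sumOver L (X h₁))          ∎

  𝔼-∑∑ : ∀ m k (F : (Fin n → Fin A) → Fin m → Fin k → ℚ) →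
          𝔼 (λ h → ∑[ i < m ] ∑[ j < k ] F h i j) ≡ ∑[ i < m ] ∑[ j < k ] 𝔼 (λ h → F h i j)
  𝔼-∑∑ m k F = trans (𝔼-∑ m (λ h i → ∑[ j < k ] F h i j)) (sum-cong-≗ (λ i → 𝔼-∑ k (λ h → F h i)))

  𝔼-*ʳ : ∀ c (F : (Fin n → Fin A) → ℚ) → 𝔼 (λ h → F h * c) ≡ 𝔼 F * c
  𝔼-*ʳ c F = trans (𝔼-cong (λ h → *-comm (F h) c)) (trans (𝔼-*ˡ c F) (*-comm c (𝔼 F)))

  𝔼-resample-const : ∀ (x : Fin n) (F : (Fin n → Fin A) → ℚ) → Extensional F → ∀ c →
                     (∀ h → ∑[ a < A ] F (h [ x ]≔ a) ≡ c) → 𝔼 F ≡ 1 /ℕ A * c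
  𝔼-resample-const x F F-ext c ∑≡c =
    trans (𝔼-resample x F F-ext) (trans (𝔼-cong (λ h → cong (1 /ℕ A *_) (∑≡c h))) (𝔼-const _))

-- Collisions of a random hash

collide : ∀ {n A} → (Fin n → Fin A) → Fin n → Fin n → ℚ
collide h y y′ = δ (h y) (h y′)

module _ {n A : ℕ} .{{_ : NonZero A}} where

  private
    u : ℚ
    u = 1 /ℕ A

  collisionProb : Fin n → Fin n → ℚ
  collisionProb y y′ = u + (1ℚ - u) * δ y y′

  excess : (Fin n → Fin A) → Fin n → Fin n → ℚ
  excess h y y′ = collide h y y′ - collisionProb y y′

  excess-cong : ∀ {h h′} y y′ → h ≗ h′ → excess h y y′ ≡ excess h′ y y′
  excess-cong y y′ h≗h′ = cong (_- collisionProb y y′) (cong₂ δ (h≗h′ y) (h≗h′ y′))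

  collisionProb-refl : ∀ y → collisionProb y y ≡ 1ℚ
  collisionProb-refl y = trans (cong (λ d → u + (1ℚ - u) * d) (δ-refl y)) (certain u)
    where
    certain : ∀ u → u + (1ℚ - u) * 1ℚ ≡ 1ℚ
    certain = solve-∀ ℚ-ring

  collisionProb-≢ : ∀ {y y′} → y ≢ y′ → collisionProb y y′ ≡ u
  collisionProb-≢ y≢y′ = trans (cong (λ d → u + (1ℚ - u) * d) (δ-≢ y≢y′)) (uniform u)
    where
    uniform : ∀ u → u + (1ℚ - u) * 0ℚ ≡ u
    uniform = solve-∀ ℚ-ring

  excess-diag : ∀ h y → excess h y y ≡ 0ℚ
  excess-diag h y = trans (cong₂ _-_ (δ-refl (h y)) (collisionProb-refl y)) (+-inverseʳ 1ℚ)

  excess-sym : ∀ h y y′ → excess h y y′ ≡ excess h y′ y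
  excess-sym h y y′ = cong₂ (λ c d → c - (u + (1ℚ - u) * d)) (δ-sym (h y) (h y′)) (δ-sym y y′)

  excess-≢ : ∀ h {y y′} → y ≢ y′ → excess h y y′ ≡ collide h y y′ - u
  excess-≢ h {y} {y′} y≢y′ = cong (λ p → collide h y y′ - p) (collisionProb-≢ y≢y′)

  excess-resample-here : ∀ h {y y′} a → y ≢ y′ → excess (h [ y ]≔ a) y y′ ≡ δ (h y′) a - u
  excess-resample-here h {y} {y′} a y≢y′ = trans (excess-≢ (h [ y ]≔ a) y≢y′)
    (cong (_- u) (trans (cong₂ δ ([]≔-here h y a) ([]≔-away h a (y≢y′ ∘ sym))) (δ-sym a (h y′))))

  excess-resample-away : ∀ h {x} a z z′ → z ≢ x → z′ ≢ x → excess (h [ x ]≔ a) z z′ ≡ excess h z z′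
  excess-resample-away h a z z′ z≢x z′≢x =
    cong (_- collisionProb z z′) (cong₂ δ ([]≔-away h a z≢x) ([]≔-away h a z′≢x))

  ∑-δ-minus-u : ∀ b → ∑[ a < A ] (δ b a - u) ≡ 0ℚ
  ∑-δ-minus-u b = begin
    ∑[ a < A ] (δ b a - u)   ≡⟨ ∑-distrib-minus (δ b) (λ _ → u) ⟩
    sum (δ b) - ∑[ a < A ] u ≡⟨ cong₂ _-_ (∑-δ b) (trans (∑-const A u) (fromℕ-*-1/ℕ A)) ⟩
    1ℚ - 1ℚ                  ≡⟨ +-inverseʳ 1ℚ ⟩
    0ℚ                       ∎
    where open ≡-Reasoning

  𝔼-collide : ∀ y y′ → 𝔼 (λ h → collide h y y′) ≡ collisionProb y y′
  𝔼-collide y y′ = by-cases (y Fin.≟ y′)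
    where
    open ≡-Reasoning
    by-cases : Dec (y ≡ y′) → 𝔼 (λ h → collide h y y′) ≡ collisionProb y y′
    by-cases (yes refl) = trans (𝔼-cong (λ h → δ-refl (h y))) (trans (𝔼-const 1ℚ) (sym (collisionProb-refl y)))
    by-cases (no y≢y′)  = begin
      𝔼 (λ h → collide h y y′)  ≡⟨ 𝔼-resample-const y _ (λ h≗h′ → cong₂ δ (h≗h′ y) (h≗h′ y′)) 1ℚ resampled ⟩
      u * 1ℚ                    ≡⟨ *-identityʳ u ⟩
      u                         ≡⟨ collisionProb-≢ y≢y′ ⟨
      collisionProb y y′        ∎
      where
      resampled : ∀ h → ∑[ a < A ] collide (h [ y ]≔ a) y y′ ≡ 1ℚ
      resampled h = trans (sum-cong-≗ λ a → trans (cong₂ δ ([]≔-here h y a) ([]≔-away h a (y≢y′ ∘ sym)))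
                                                 (δ-sym a (h y′)))
                          (∑-δ (h y′))

  𝔼-excess : ∀ y y′ → 𝔼 (λ h → excess h y y′) ≡ 0ℚ
  𝔼-excess y y′ = begin
    𝔼 (λ h → collide h y y′ + - collisionProb y y′)          ≡⟨ 𝔼-+ _ _ ⟩
    𝔼 (λ h → collide h y y′) + 𝔼 (λ _ → - collisionProb y y′) ≡⟨ cong₂ _+_ (𝔼-collide y y′) (𝔼-const _) ⟩
    collisionProb y y′ - collisionProb y y′                    ≡⟨ +-inverseʳ (collisionProb y y′) ⟩
    0ℚ                                                         ∎
    where open ≡-Reasoning

  𝔼-excess² : ∀ {y y′} → y ≢ y′ → 𝔼 (λ h → excess h y y′ * excess h y y′) ≡ u * (1ℚ - u)
  𝔼-excess² {y} {y′} y≢y′ = begin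
    𝔼 (λ h → excess h y y′ * excess h y y′)                 ≡⟨ 𝔼-cong linearise ⟩
    𝔼 (λ h → (1ℚ - u - u) * collide h y y′ + u * u)         ≡⟨ 𝔼-+ _ _ ⟩
    𝔼 (λ h → (1ℚ - u - u) * collide h y y′) + 𝔼 (λ _ → u * u)
      ≡⟨ cong₂ _+_ (trans (𝔼-*ˡ (1ℚ - u - u) (λ h → collide h y y′))
                          (cong ((1ℚ - u - u) *_) (trans (𝔼-collide y y′) (collisionProb-≢ y≢y′))))
                   (𝔼-const _) ⟩
    (1ℚ - u - u) * u + u * u                                ≡⟨ variance u ⟩
    u * (1ℚ - u)                                            ∎
    where
    open ≡-Reasoning
    variance : ∀ u → (1ℚ - u - u) * u + u * u ≡ u * (1ℚ - u)
    variance = solve-∀ ℚ-ring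
    square : ∀ c u → (c - u) * (c - u) ≡ c * c - u * c - u * c + u * u
    square = solve-∀ ℚ-ring
    collect : ∀ c u → c - u * c - u * c + u * u ≡ (1ℚ - u - u) * c + u * u
    collect = solve-∀ ℚ-ring
    linearise : ∀ h → excess h y y′ * excess h y y′ ≡ (1ℚ - u - u) * collide h y y′ + u * u
    linearise h = begin
      excess h y y′ * excess h y y′                   ≡⟨ cong (λ e → e * e) (excess-≢ h y≢y′) ⟩
      (c - u) * (c - u)                               ≡⟨ square c u ⟩
      c * c - u * c - u * c + u * u                   ≡⟨ cong (λ d → d - u * c - u * c + u * u) (δ-idem (h y) (h y′)) ⟩
      c - u * c - u * c + u * u                       ≡⟨ collect c u ⟩
      (1ℚ - u - u) * c + u * u                        ∎
      where c = collide h y y′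

  𝔼-excess-excess-away : ∀ {y y′} z z′ → y ≢ y′ → y ≢ z → y ≢ z′ →
                         𝔼 (λ h → excess h y y′ * excess h z z′) ≡ 0ℚ
  𝔼-excess-excess-away {y} {y′} z z′ y≢y′ y≢z y≢z′ = begin
    𝔼 (λ h → excess h y y′ * excess h z z′)  ≡⟨ 𝔼-resample-const y _ ext 0ℚ resampled ⟩
    u * 0ℚ                                   ≡⟨ *-zeroʳ u ⟩
    0ℚ                                       ∎
    where
    open ≡-Reasoning
    ext : Extensional (λ h → excess h y y′ * excess h z z′)
    ext h≗h′ = cong₂ _*_ (excess-cong y y′ h≗h′) (excess-cong z z′ h≗h′)
    resampled : ∀ h → ∑[ a < A ] (excess (h [ y ]≔ a) y y′ * excess (h [ y ]≔ a) z z′) ≡ 0ℚ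
    resampled h = begin
      ∑[ a < A ] (excess (h [ y ]≔ a) y y′ * excess (h [ y ]≔ a) z z′)
        ≡⟨ sum-cong-≗ (λ a → cong₂ _*_ (excess-resample-here h a y≢y′)
                                       (excess-resample-away h a z z′ (y≢z ∘ sym) (y≢z′ ∘ sym))) ⟩
      ∑[ a < A ] ((δ (h y′) a - u) * excess h z z′)
        ≡⟨ *-distribʳ-sum (excess h z z′) (λ a → δ (h y′) a - u) ⟨
      ∑[ a < A ] (δ (h y′) a - u) * excess h z z′
        ≡⟨ cong (_* excess h z z′) (∑-δ-minus-u (h y′)) ⟩
      0ℚ * excess h z z′
        ≡⟨ *-zeroˡ (excess h z z′) ⟩
      0ℚ ∎

  𝔼-excess-excess : ∀ {y y′} → y ≢ y′ → ∀ z z′ →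
    𝔼 (λ h → excess h y y′ * excess h z z′) ≡ u * (1ℚ - u) * (δ y z * δ y′ z′ + δ y z′ * δ y′ z)
  𝔼-excess-excess {y} {y′} y≢y′ z z′ = cases z z′ (y Fin.≟ z) (y Fin.≟ z′) (y′ Fin.≟ z) (y′ Fin.≟ z′)
    where
    c = u * (1ℚ - u)
    vanishˡ : ∀ c a b → c * (0ℚ * a + 0ℚ * b) ≡ 0ℚ
    vanishˡ = solve-∀ ℚ-ring
    vanishʳ : ∀ c a b → c * (a * 0ℚ + b * 0ℚ) ≡ 0ℚ
    vanishʳ = solve-∀ ℚ-ring
    oneˡ : ∀ c → c ≡ c * (1ℚ * 1ℚ + 0ℚ * 0ℚ)
    oneˡ = solve-∀ ℚ-ring
    oneʳ : ∀ c → c ≡ c * (0ℚ * 0ℚ + 1ℚ * 1ℚ)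
    oneʳ = solve-∀ ℚ-ring
    y′≢y = y≢y′ ∘ sym
    -- Either a point of {y, y′} lies outside {z, z′}, or {z, z′} = {y, y′}.
    cases : ∀ z z′ → Dec (y ≡ z) → Dec (y ≡ z′) → Dec (y′ ≡ z) → Dec (y′ ≡ z′) →
            𝔼 (λ h → excess h y y′ * excess h z z′) ≡ c * (δ y z * δ y′ z′ + δ y z′ * δ y′ z)
    cases z z′ (no y≢z) (no y≢z′) _ _ =
      trans (𝔼-excess-excess-away z z′ y≢y′ y≢z y≢z′)
            (sym (trans (cong₂ (λ p q → c * (p * δ y′ z′ + q * δ y′ z)) (δ-≢ y≢z) (δ-≢ y≢z′))
                        (vanishˡ c (δ y′ z′) (δ y′ z))))
    cases z z′ _ _ (no y′≢z) (no y′≢z′) =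
      trans (𝔼-cong (λ h → cong (_* excess h z z′) (excess-sym h y y′)))
        (trans (𝔼-excess-excess-away z z′ y′≢y y′≢z y′≢z′)
               (sym (trans (cong₂ (λ p q → c * (δ y z * p + δ y z′ * q)) (δ-≢ y′≢z′) (δ-≢ y′≢z))
                           (vanishʳ c (δ y z) (δ y z′)))))
    cases .y .y′ (yes refl) _ _ (yes refl) =
      trans (𝔼-excess² y≢y′)
            (trans (oneˡ c) (cong₂ (λ p q → c * (p + q)) (cong₂ _*_ (sym (δ-refl y)) (sym (δ-refl y′)))
                                                         (cong₂ _*_ (sym (δ-≢ y≢y′)) (sym (δ-≢ y′≢y)))))
    cases .y′ .y _ (yes refl) (yes refl) _ =
      trans (𝔼-cong (λ h → cong (excess h y y′ *_) (excess-sym h y′ y)))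
        (trans (𝔼-excess² y≢y′)
               (trans (oneʳ c) (cong₂ (λ p q → c * (p + q)) (cong₂ _*_ (sym (δ-≢ y≢y′)) (sym (δ-≢ y′≢y)))
                                                            (cong₂ _*_ (sym (δ-refl y)) (sym (δ-refl y′))))))
    cases z z′ (yes y≡z) _ (yes y′≡z) _ = ⊥-elim (y≢y′ (trans y≡z (sym y′≡z)))
    cases z z′ _ (yes y≡z′) _ (yes y′≡z′) = ⊥-elim (y≢y′ (trans y≡z′ (sym y′≡z′)))

-- Bucketing the columns of a matrix

‖_‖² : ∀ {m k} → (Fin m → Fin k → ℚ) → ℚ
‖_‖² {m} {k} M = ∑[ i < m ] ∑[ j < k ] (M i j * M i j)

‖flip‖² : ∀ {m k} (M : Fin m → Fin k → ℚ) → ‖ flip M ‖² ≡ ‖ M ‖²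
‖flip‖² M = ∑-comm (λ j i → M i j * M i j)

bucketCols : ∀ {m n A} → (Fin n → Fin A) → (Fin m → Fin n → ℚ) → Fin m → Fin A → ℚ
bucketCols {n = n} h M i b = ∑[ y < n ] (δ (h y) b * M i y)

bucketRows : ∀ {n k A} → (Fin n → Fin A) → (Fin n → Fin k → ℚ) → Fin A → Fin k → ℚ
bucketRows h M = flip (bucketCols h (flip M))

gram : ∀ {m n} → (Fin m → Fin n → ℚ) → Fin n → Fin n → ℚ
gram {m} M y y′ = ∑[ i < m ] (M i y * M i y′)

∑-buckets² : ∀ {n A} (h : Fin n → Fin A) (v : Fin n → ℚ) →
  ∑[ b < A ] (∑[ y < n ] (δ (h y) b * v y) * ∑[ y < n ] (δ (h y) b * v y))
  ≡ ∑[ y < n ] ∑[ y′ < n ] (collide h y y′ * (v y * v y′))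
∑-buckets² {n} {A} h v = begin
  ∑[ b < A ] (∑[ y < n ] (δ (h y) b * v y) * ∑[ y < n ] (δ (h y) b * v y))
    ≡⟨ sum-cong-≗ (λ b → ∑-*-∑ (λ y → δ (h y) b * v y) (λ y → δ (h y) b * v y)) ⟩
  ∑[ b < A ] ∑[ y < n ] ∑[ y′ < n ] ((δ (h y) b * v y) * (δ (h y′) b * v y′))
    ≡⟨ ∑-comm₃ (λ b y y′ → (δ (h y) b * v y) * (δ (h y′) b * v y′)) ⟩
  ∑[ y < n ] ∑[ y′ < n ] ∑[ b < A ] ((δ (h y) b * v y) * (δ (h y′) b * v y′))
    ≡⟨ sum-cong-≗ (λ y → sum-cong-≗ (λ y′ → trans
         (sum-cong-≗ (λ b → regroup (δ (h y) b) (v y) (δ (h y′) b) (v y′)))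
         (∑-δ-* (h y) (λ b → δ (h y′) b * (v y * v y′))))) ⟩
  ∑[ y < n ] ∑[ y′ < n ] (δ (h y′) (h y) * (v y * v y′))
    ≡⟨ sum-cong-≗ (λ y → sum-cong-≗ (λ y′ → cong (_* (v y * v y′)) (δ-sym (h y′) (h y)))) ⟩
  ∑[ y < n ] ∑[ y′ < n ] (collide h y y′ * (v y * v y′)) ∎
  where
  open ≡-Reasoning
  regroup : ∀ d a d′ a′ → (d * a) * (d′ * a′) ≡ d * (d′ * (a * a′))
  regroup = solve-∀ ℚ-ring

‖bucketCols‖²-gram : ∀ {m n A} (h : Fin n → Fin A) (M : Fin m → Fin n → ℚ) →
                  ‖ bucketCols h M ‖² ≡ ∑[ y < n ] ∑[ y′ < n ] (collide h y y′ * gram M y y′)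
‖bucketCols‖²-gram {m} {n} h M = begin
  ‖ bucketCols h M ‖²
    ≡⟨ sum-cong-≗ (λ i → ∑-buckets² h (M i)) ⟩
  ∑[ i < m ] ∑[ y < n ] ∑[ y′ < n ] (collide h y y′ * (M i y * M i y′))
    ≡⟨ ∑-comm₃ (λ i y y′ → collide h y y′ * (M i y * M i y′)) ⟩
  ∑[ y < n ] ∑[ y′ < n ] ∑[ i < m ] (collide h y y′ * (M i y * M i y′))
    ≡⟨ sum-cong-≗ (λ y → sum-cong-≗ (λ y′ → *-distribˡ-sum (collide h y y′) (λ i → M i y * M i y′))) ⟨
  ∑[ y < n ] ∑[ y′ < n ] (collide h y y′ * gram M y y′) ∎
  where open ≡-Reasoning

module _ {m n : ℕ} (M : Fin m → Fin n → ℚ) where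

  gram-diag : ∑[ y < n ] gram M y y ≡ ‖ M ‖²
  gram-diag = ∑-comm (λ y i → M i y * M i y)

  gram-sym : ∀ y y′ → gram M y y′ ≡ gram M y′ y
  gram-sym y y′ = sum-cong-≗ (λ i → *-comm (M i y) (M i y′))

  gram-rows : (∀ i → ∑[ y < n ] M i y ≡ 0ℚ) → ∀ y → ∑[ y′ < n ] gram M y y′ ≡ 0ℚ
  gram-rows rows y = begin
    ∑[ y′ < n ] ∑[ i < m ] (M i y * M i y′)   ≡⟨ ∑-comm (λ y′ i → M i y * M i y′) ⟩
    ∑[ i < m ] ∑[ y′ < n ] (M i y * M i y′)   ≡⟨ sum-cong-≗ (λ i → *-distribˡ-sum (M i y) (M i)) ⟨
    ∑[ i < m ] (M i y * ∑[ y′ < n ] M i y′)   ≡⟨ sum-cong-≗ (λ i → trans (cong (M i y *_) (rows i)) (*-zeroʳ (M i y))) ⟩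
    ∑[ i < m ] 0ℚ                             ≡⟨ sum-replicate-zero m ⟩
    0ℚ                                        ∎
    where open ≡-Reasoning

  ∑∑-gram² : ∑[ y < n ] ∑[ y′ < n ] (gram M y y′ * gram M y y′) ≤ℚ ‖ M ‖² * ‖ M ‖²
  ∑∑-gram² = begin
    ∑[ y < n ] ∑[ y′ < n ] (gram M y y′ * gram M y y′)
      ≤⟨ ∑-mono-≤ (λ y → ∑-mono-≤ (λ y′ → cauchy-schwarz (λ i → M i y) (λ i → M i y′))) ⟩
    ∑[ y < n ] ∑[ y′ < n ] (gram M y y * gram M y′ y′)
      ≡⟨ ∑-*-∑ (λ y → gram M y y) (λ y → gram M y y) ⟨
    ∑[ y < n ] gram M y y * ∑[ y < n ] gram M y y
      ≡⟨ cong₂ _*_ gram-diag gram-diag ⟩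
    ‖ M ‖² * ‖ M ‖² ∎
    where open ≤-Reasoning

module _ {m n A : ℕ} .{{_ : NonZero A}} (M : Fin m → Fin n → ℚ) (rows : ∀ i → ∑[ y < n ] M i y ≡ 0ℚ) where

  private
    u c : ℚ
    u = 1 /ℕ A
    c = u * (1ℚ - u)

    0≤c : 0ℚ ≤ℚ c
    0≤c = 0≤* (0≤1/ℕ A) (0≤1-1/ℕ A)

  fluctuation : (Fin n → Fin A) → ℚ
  fluctuation h = ∑[ y < n ] ∑[ y′ < n ] (excess h y y′ * gram M y y′)

  ∑∑-collisionProb-gram : ∑[ y < n ] ∑[ y′ < n ] (collisionProb y y′ * gram M y y′) ≡ (1ℚ - u) * ‖ M ‖²
  ∑∑-collisionProb-gram = begin
    ∑[ y < n ] ∑[ y′ < n ] (collisionProb y y′ * gram M y y′)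
      ≡⟨ sum-cong-≗ (λ y → trans (sum-cong-≗ (λ y′ → spread u (δ y y′) (gram M y y′)))
                                 (∑-distrib-+ (λ y′ → u * gram M y y′) (λ y′ → (1ℚ - u) * (δ y y′ * gram M y y′)))) ⟩
    ∑[ y < n ] (∑[ y′ < n ] (u * gram M y y′) + ∑[ y′ < n ] ((1ℚ - u) * (δ y y′ * gram M y y′)))
      ≡⟨ sum-cong-≗ (λ y → cong₂ _+_ (*-distribˡ-sum u (gram M y))
                                     (*-distribˡ-sum (1ℚ - u) (λ y′ → δ y y′ * gram M y y′))) ⟨
    ∑[ y < n ] (u * ∑[ y′ < n ] gram M y y′ + (1ℚ - u) * ∑[ y′ < n ] (δ y y′ * gram M y y′))
      ≡⟨ sum-cong-≗ (λ y → cong₂ (λ s t → u * s + (1ℚ - u) * t) (gram-rows M rows y) (∑-δ-* y (gram M y))) ⟩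
    ∑[ y < n ] (u * 0ℚ + (1ℚ - u) * gram M y y)
      ≡⟨ sum-cong-≗ (λ y → drop u (gram M y y)) ⟩
    ∑[ y < n ] ((1ℚ - u) * gram M y y)
      ≡⟨ *-distribˡ-sum (1ℚ - u) (λ y → gram M y y) ⟨
    (1ℚ - u) * ∑[ y < n ] gram M y y
      ≡⟨ cong ((1ℚ - u) *_) (gram-diag M) ⟩
    (1ℚ - u) * ‖ M ‖² ∎
    where
    open ≡-Reasoning
    spread : ∀ u d g → (u + (1ℚ - u) * d) * g ≡ u * g + (1ℚ - u) * (d * g)
    spread = solve-∀ ℚ-ring
    drop : ∀ u g → u * 0ℚ + (1ℚ - u) * g ≡ (1ℚ - u) * g
    drop = solve-∀ ℚ-ring

  ‖bucketCols‖²-split : ∀ h → ‖ bucketCols h M ‖² ≡ (1ℚ - u) * ‖ M ‖² + fluctuation h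
  ‖bucketCols‖²-split h = begin
    ‖ bucketCols h M ‖²
      ≡⟨ ‖bucketCols‖²-gram h M ⟩
    ∑[ y < n ] ∑[ y′ < n ] (collide h y y′ * gram M y y′)
      ≡⟨ sum-cong-≗ (λ y → trans (sum-cong-≗ (λ y′ → split (collide h y y′) (collisionProb y y′) (gram M y y′)))
           (∑-distrib-+ (λ y′ → collisionProb y y′ * gram M y y′) (λ y′ → excess h y y′ * gram M y y′))) ⟩
    ∑[ y < n ] (∑[ y′ < n ] (collisionProb y y′ * gram M y y′) + ∑[ y′ < n ] (excess h y y′ * gram M y y′))
      ≡⟨ ∑-distrib-+ _ (λ y → ∑[ y′ < n ] (excess h y y′ * gram M y y′)) ⟩
    ∑[ y < n ] ∑[ y′ < n ] (collisionProb y y′ * gram M y y′) + fluctuation h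
      ≡⟨ cong (_+ fluctuation h) ∑∑-collisionProb-gram ⟩
    (1ℚ - u) * ‖ M ‖² + fluctuation h ∎
    where
    open ≡-Reasoning
    split : ∀ k p g → k * g ≡ p * g + (k - p) * g
    split = solve-∀ ℚ-ring

  𝔼-fluctuation : 𝔼 fluctuation ≡ 0ℚ
  𝔼-fluctuation = begin
    𝔼 fluctuation
      ≡⟨ 𝔼-∑∑ n n (λ h y y′ → excess h y y′ * gram M y y′) ⟩
    ∑[ y < n ] ∑[ y′ < n ] 𝔼 (λ h → excess h y y′ * gram M y y′)
      ≡⟨ sum-cong-≗ (λ y → sum-cong-≗ (λ y′ → trans (𝔼-*ʳ (gram M y y′) (λ h → excess h y y′))
           (trans (cong (_* gram M y y′) (𝔼-excess y y′)) (*-zeroˡ (gram M y y′))))) ⟩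
    ∑[ y < n ] ∑[ y′ < n ] 0ℚ
      ≡⟨ trans (sum-cong-≗ {n} (λ y → sum-replicate-zero n)) (sum-replicate-zero n) ⟩
    0ℚ ∎
    where open ≡-Reasoning

  ∑∑-gram-𝔼-excess-excess : ∀ {y y′} → y ≢ y′ →
    ∑[ z < n ] ∑[ z′ < n ] (gram M z z′ * 𝔼 (λ h → excess h y y′ * excess h z z′))
    ≡ c * (gram M y y′ + gram M y′ y)
  ∑∑-gram-𝔼-excess-excess {y} {y′} y≢y′ = begin
    ∑[ z < n ] ∑[ z′ < n ] (gram M z z′ * 𝔼 (λ h → excess h y y′ * excess h z z′))
      ≡⟨ sum-cong-≗ (λ z → sum-cong-≗ (λ z′ → trans (cong (gram M z z′ *_) (𝔼-excess-excess y≢y′ z z′))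
           (separate (δ y z) (δ y′ z′) (δ y z′) (δ y′ z) c (gram M z z′)))) ⟩
    ∑[ z < n ] ∑[ z′ < n ] (δ y z * (δ y′ z′ * (c * gram M z z′)) + δ y′ z * (δ y z′ * (c * gram M z z′)))
      ≡⟨ sum-cong-≗ (λ z → trans (∑-distrib-+ (λ z′ → δ y z * (δ y′ z′ * (c * gram M z z′)))
                                               (λ z′ → δ y′ z * (δ y z′ * (c * gram M z z′))))
           (cong₂ _+_ (trans (sym (*-distribˡ-sum (δ y z) (λ z′ → δ y′ z′ * (c * gram M z z′))))
                             (cong (δ y z *_) (∑-δ-* y′ (λ z′ → c * gram M z z′))))
                      (trans (sym (*-distribˡ-sum (δ y′ z) (λ z′ → δ y z′ * (c * gram M z z′))))
                             (cong (δ y′ z *_) (∑-δ-* y (λ z′ → c * gram M z z′)))))) ⟩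
    ∑[ z < n ] (δ y z * (c * gram M z y′) + δ y′ z * (c * gram M z y))
      ≡⟨ trans (∑-distrib-+ (λ z → δ y z * (c * gram M z y′)) (λ z → δ y′ z * (c * gram M z y)))
               (cong₂ _+_ (∑-δ-* y (λ z → c * gram M z y′)) (∑-δ-* y′ (λ z → c * gram M z y))) ⟩
    c * gram M y y′ + c * gram M y′ y
      ≡⟨ *-distribˡ-+ c (gram M y y′) (gram M y′ y) ⟨
    c * (gram M y y′ + gram M y′ y) ∎
    where
    open ≡-Reasoning
    separate : ∀ a b p q c g → g * (c * (a * b + p * q)) ≡ a * (b * (c * g)) + q * (p * (c * g))
    separate = solve-∀ ℚ-ring

  gram-𝔼-excess-excess-bound : ∀ y y′ →
    gram M y y′ * ∑[ z < n ] ∑[ z′ < n ] (gram M z z′ * 𝔼 (λ h → excess h y y′ * excess h z z′))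
    ≤ℚ (c + c) * (gram M y y′ * gram M y y′)
  gram-𝔼-excess-excess-bound y y′ = by-cases (y Fin.≟ y′)
    where
    g = gram M y y′
    0≤bound : 0ℚ ≤ℚ (c + c) * (g * g)
    0≤bound = 0≤* (0≤+ 0≤c 0≤c) (0≤*-self g)
    double : ∀ c g → g * (c * (g + g)) ≡ (c + c) * (g * g)
    double = solve-∀ ℚ-ring
    by-cases : Dec (y ≡ y′) →
      g * ∑[ z < n ] ∑[ z′ < n ] (gram M z z′ * 𝔼 (λ h → excess h y y′ * excess h z z′)) ≤ℚ (c + c) * (g * g)
    by-cases (yes refl) = ≤-trans (≤-reflexive (trans (cong (g *_) vanishes) (*-zeroʳ g))) 0≤bound
      where
      vanishes : ∑[ z < n ] ∑[ z′ < n ] (gram M z z′ * 𝔼 (λ h → excess h y y * excess h z z′)) ≡ 0ℚ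
      vanishes = trans (sum-cong-≗ (λ z → sum-cong-≗ (λ z′ → trans
          (cong (gram M z z′ *_) (trans (𝔼-cong (λ h → trans (cong (_* excess h z z′) (excess-diag h y))
                                                             (*-zeroˡ (excess h z z′))))
                                        (𝔼-const 0ℚ)))
          (*-zeroʳ (gram M z z′)))))
        (trans (sum-cong-≗ {n} (λ z → sum-replicate-zero n)) (sum-replicate-zero n))
    by-cases (no y≢y′) = ≤-reflexive (begin
      g * ∑[ z < n ] ∑[ z′ < n ] (gram M z z′ * 𝔼 (λ h → excess h y y′ * excess h z z′))
        ≡⟨ cong (g *_) (∑∑-gram-𝔼-excess-excess y≢y′) ⟩
      g * (c * (g + gram M y′ y))
        ≡⟨ cong (λ g′ → g * (c * (g + g′))) (gram-sym M y′ y) ⟩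
      g * (c * (g + g))
        ≡⟨ double c g ⟩
      (c + c) * (g * g) ∎)
      where open ≡-Reasoning

  𝔼-fluctuation² : 𝔼 (λ h → fluctuation h * fluctuation h) ≤ℚ (c + c) * (‖ M ‖² * ‖ M ‖²)
  𝔼-fluctuation² = begin
    𝔼 (λ h → fluctuation h * fluctuation h)
      ≡⟨ 𝔼-cong (λ h → ∑∑-*-∑∑ (W h) (W h)) ⟩
    𝔼 (λ h → ∑[ y < n ] ∑[ y′ < n ] ∑[ z < n ] ∑[ z′ < n ] (W h y y′ * W h z z′))
      ≡⟨ trans (𝔼-∑∑ n n (λ h y y′ → ∑[ z < n ] ∑[ z′ < n ] (W h y y′ * W h z z′)))
               (sum-cong-≗ (λ y → sum-cong-≗ (λ y′ → 𝔼-∑∑ n n (λ h z z′ → W h y y′ * W h z z′)))) ⟩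
    ∑[ y < n ] ∑[ y′ < n ] ∑[ z < n ] ∑[ z′ < n ] 𝔼 (λ h → W h y y′ * W h z z′)
      ≡⟨ sum-cong-≗ (λ y → sum-cong-≗ (λ y′ → trans
           (sum-cong-≗ (λ z → sum-cong-≗ (λ z′ → pull-out y y′ z z′)))
           (sym (*-distribˡ-∑∑ (gram M y y′) (λ z z′ → gram M z z′ * 𝔼 (λ h → excess h y y′ * excess h z z′)))))) ⟩
    ∑[ y < n ] ∑[ y′ < n ]
      (gram M y y′ * ∑[ z < n ] ∑[ z′ < n ] (gram M z z′ * 𝔼 (λ h → excess h y y′ * excess h z z′)))
      ≤⟨ ∑-mono-≤ (λ y → ∑-mono-≤ (λ y′ → gram-𝔼-excess-excess-bound y y′)) ⟩
    ∑[ y < n ] ∑[ y′ < n ] ((c + c) * (gram M y y′ * gram M y y′))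
      ≡⟨ *-distribˡ-∑∑ (c + c) (λ y y′ → gram M y y′ * gram M y y′) ⟨
    (c + c) * ∑[ y < n ] ∑[ y′ < n ] (gram M y y′ * gram M y y′)
      ≤⟨ *-monoˡ-≤ (0≤+ 0≤c 0≤c) (∑∑-gram² M) ⟩
    (c + c) * (‖ M ‖² * ‖ M ‖²) ∎
    where
    open ≤-Reasoning
    W : (Fin n → Fin A) → Fin n → Fin n → ℚ
    W h y y′ = excess h y y′ * gram M y y′
    regroup : ∀ e g e′ g′ → e * g * (e′ * g′) ≡ g * (g′ * (e * e′))
    regroup = solve-∀ ℚ-ring
    pull-out : ∀ y y′ z z′ → 𝔼 (λ h → W h y y′ * W h z z′)
                           ≡ gram M y y′ * (gram M z z′ * 𝔼 (λ h → excess h y y′ * excess h z z′))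
    pull-out y y′ z z′ = trans (𝔼-cong (λ h → regroup (excess h y y′) (gram M y y′) (excess h z z′) (gram M z z′)))
      (trans (𝔼-*ˡ (gram M y y′) _) (cong (gram M y y′ *_) (𝔼-*ˡ (gram M z z′) _)))

  𝔼-‖bucketCols‖² : 𝔼 (λ h → ‖ bucketCols h M ‖²) ≡ (1ℚ - u) * ‖ M ‖²
  𝔼-‖bucketCols‖² = begin
    𝔼 (λ h → ‖ bucketCols h M ‖²)
      ≡⟨ 𝔼-cong ‖bucketCols‖²-split ⟩
    𝔼 (λ h → (1ℚ - u) * ‖ M ‖² + fluctuation h)
      ≡⟨ 𝔼-+ (λ _ → (1ℚ - u) * ‖ M ‖²) fluctuation ⟩
    𝔼 (λ _ → (1ℚ - u) * ‖ M ‖²) + 𝔼 fluctuation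
      ≡⟨ cong₂ _+_ (𝔼-const _) 𝔼-fluctuation ⟩
    (1ℚ - u) * ‖ M ‖² + 0ℚ
      ≡⟨ +-identityʳ _ ⟩
    (1ℚ - u) * ‖ M ‖² ∎
    where open ≡-Reasoning

  𝔼-‖bucketCols‖⁴ : 𝔼 (λ h → ‖ bucketCols h M ‖² * ‖ bucketCols h M ‖²)
                      ≤ℚ (1ℚ - u * u) * (‖ M ‖² * ‖ M ‖²)
  𝔼-‖bucketCols‖⁴ = begin
    𝔼 (λ h → ‖ bucketCols h M ‖² * ‖ bucketCols h M ‖²)
      ≡⟨ 𝔼-cong (λ h → trans (cong (λ z → z * z) (‖bucketCols‖²-split h)) (square Z₀ (fluctuation h))) ⟩
    𝔼 (λ h → (Z₀ * Z₀ + (Z₀ + Z₀) * fluctuation h) + fluctuation h * fluctuation h)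
      ≡⟨ trans (𝔼-+ (λ h → Z₀ * Z₀ + (Z₀ + Z₀) * fluctuation h) (λ h → fluctuation h * fluctuation h))
               (cong (_+ 𝔼 (λ h → fluctuation h * fluctuation h))
                     (trans (𝔼-+ (λ _ → Z₀ * Z₀) (λ h → (Z₀ + Z₀) * fluctuation h))
                            (cong₂ _+_ (𝔼-const (Z₀ * Z₀)) (trans (𝔼-*ˡ (Z₀ + Z₀) fluctuation)
                                                                  (cong ((Z₀ + Z₀) *_) 𝔼-fluctuation))))) ⟩
    Z₀ * Z₀ + (Z₀ + Z₀) * 0ℚ + 𝔼 (λ h → fluctuation h * fluctuation h)
      ≤⟨ +-monoʳ-≤ (Z₀ * Z₀ + (Z₀ + Z₀) * 0ℚ) 𝔼-fluctuation² ⟩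
    Z₀ * Z₀ + (Z₀ + Z₀) * 0ℚ + (c + c) * (‖ M ‖² * ‖ M ‖²)
      ≡⟨ collect u ‖ M ‖² ⟩
    (1ℚ - u * u) * (‖ M ‖² * ‖ M ‖²) ∎
    where
    open ≤-Reasoning
    Z₀ : ℚ
    Z₀ = (1ℚ - u) * ‖ M ‖²
    square : ∀ z f → (z + f) * (z + f) ≡ (z * z + (z + z) * f) + f * f
    square = solve-∀ ℚ-ring
    collect : ∀ u F → (1ℚ - u) * F * ((1ℚ - u) * F) + ((1ℚ - u) * F + (1ℚ - u) * F) * 0ℚ
                      + (u * (1ℚ - u) + u * (1ℚ - u)) * (F * F) ≡ (1ℚ - u * u) * (F * F)
    collect = solve-∀ ℚ-ring

rowSum : ∀ {m k} → (Fin m → Fin k → ℚ) → Fin m → ℚ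
rowSum {k = k} P i = ∑[ j < k ] P i j

colSum : ∀ {m k} → (Fin m → Fin k → ℚ) → Fin k → ℚ
colSum {m} P j = ∑[ i < m ] P i j

centre : ∀ {m k} → (Fin m → Fin k → ℚ) → Fin m → Fin k → ℚ
centre P i j = P i j - rowSum P i * colSum P j

centre-rows : ∀ {m k} (P : Fin m → Fin k → ℚ) → ∑[ i < m ] rowSum P i ≡ 1ℚ → ∀ i → rowSum (centre P) i ≡ 0ℚ
centre-rows {m} {k} P total≡1 i = begin
  ∑[ j < k ] (P i j - rowSum P i * colSum P j)     ≡⟨ ∑-distrib-minus (P i) (λ j → rowSum P i * colSum P j) ⟩
  rowSum P i - ∑[ j < k ] (rowSum P i * colSum P j) ≡⟨ cong (λ t → rowSum P i - t) (*-distribˡ-sum (rowSum P i) (colSum P)) ⟨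
  rowSum P i - rowSum P i * ∑[ j < k ] colSum P j   ≡⟨ cong (λ t → rowSum P i - rowSum P i * t)
                                                           (trans (∑-comm (λ j i → P i j)) total≡1) ⟩
  rowSum P i - rowSum P i * 1ℚ                      ≡⟨ cancel (rowSum P i) ⟩
  0ℚ                                                ∎
  where
  open ≡-Reasoning
  cancel : ∀ r → r - r * 1ℚ ≡ 0ℚ
  cancel = solve-∀ ℚ-ring

centre-cols : ∀ {m k} (P : Fin m → Fin k → ℚ) → ∑[ i < m ] rowSum P i ≡ 1ℚ → ∀ j → colSum (centre P) j ≡ 0ℚ
centre-cols {m} {k} P total≡1 j =
  trans (sum-cong-≗ (λ i → cong (λ t → P i j - t) (*-comm (rowSum P i) (colSum P j))))
        (centre-rows (flip P) (trans (∑-comm (λ j i → P i j)) total≡1) j)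

bucket : ∀ {m k A B} → (Fin m → Fin A) → (Fin k → Fin B) → (Fin m → Fin k → ℚ) → Fin A → Fin B → ℚ
bucket {m} {k} h₁ h₂ P a b = ∑[ x < m ] ∑[ y < k ] (δ (h₁ x) a * (δ (h₂ y) b * P x y))

module _ {m k A B : ℕ} (h₁ : Fin m → Fin A) (h₂ : Fin k → Fin B) where

  bucket-minus : ∀ (P Q : Fin m → Fin k → ℚ) a b →
               bucket h₁ h₂ (λ x y → P x y - Q x y) a b ≡ bucket h₁ h₂ P a b - bucket h₁ h₂ Q a b
  bucket-minus P Q a b = trans (sum-cong-≗ λ x → trans (sum-cong-≗ λ y → distrib (δ (h₁ x) a) (δ (h₂ y) b) (P x y) (Q x y))
                                                     (∑-distrib-minus _ (λ y → δ (h₁ x) a * (δ (h₂ y) b * Q x y))))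
                             (∑-distrib-minus _ (λ x → ∑[ y < k ] (δ (h₁ x) a * (δ (h₂ y) b * Q x y))))
    where
    distrib : ∀ d e p q → d * (e * (p - q)) ≡ d * (e * p) - d * (e * q)
    distrib = solve-∀ ℚ-ring

  bucket-outer : ∀ (r : Fin m → ℚ) (s : Fin k → ℚ) a b →
                   bucket h₁ h₂ (λ x y → r x * s y) a b ≡ ∑[ x < m ] (δ (h₁ x) a * r x) * ∑[ y < k ] (δ (h₂ y) b * s y)
  bucket-outer r s a b = sym (trans (∑-*-∑ (λ x → δ (h₁ x) a * r x) (λ y → δ (h₂ y) b * s y))
    (sum-cong-≗ λ x → sum-cong-≗ λ y → regroup (δ (h₁ x) a) (r x) (δ (h₂ y) b) (s y)))
    where
    regroup : ∀ d r e s → d * r * (e * s) ≡ d * (e * (r * s))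
    regroup = solve-∀ ℚ-ring

  rowSum-bucket : ∀ (P : Fin m → Fin k → ℚ) a → rowSum (bucket h₁ h₂ P) a ≡ ∑[ x < m ] (δ (h₁ x) a * rowSum P x)
  rowSum-bucket P a = begin
    ∑[ b < B ] ∑[ x < m ] ∑[ y < k ] (δ (h₁ x) a * (δ (h₂ y) b * P x y))
      ≡⟨ ∑-comm₃ (λ b x y → δ (h₁ x) a * (δ (h₂ y) b * P x y)) ⟩
    ∑[ x < m ] ∑[ y < k ] ∑[ b < B ] (δ (h₁ x) a * (δ (h₂ y) b * P x y))
      ≡⟨ sum-cong-≗ (λ x → sum-cong-≗ λ y → trans (sum-cong-≗ λ b → swap (δ (h₁ x) a) (δ (h₂ y) b) (P x y))
                                                 (∑-δ-* (h₂ y) (const (δ (h₁ x) a * P x y)))) ⟩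
    ∑[ x < m ] ∑[ y < k ] (δ (h₁ x) a * P x y)
      ≡⟨ sum-cong-≗ (λ x → *-distribˡ-sum (δ (h₁ x) a) (P x)) ⟨
    ∑[ x < m ] (δ (h₁ x) a * rowSum P x) ∎
    where
    open ≡-Reasoning
    swap : ∀ d e p → d * (e * p) ≡ e * (d * p)
    swap = solve-∀ ℚ-ring

  colSum-bucket : ∀ (P : Fin m → Fin k → ℚ) b → colSum (bucket h₁ h₂ P) b ≡ ∑[ y < k ] (δ (h₂ y) b * colSum P y)
  colSum-bucket P b = begin
    ∑[ a < A ] ∑[ x < m ] ∑[ y < k ] (δ (h₁ x) a * (δ (h₂ y) b * P x y))
      ≡⟨ ∑-comm₃ (λ a x y → δ (h₁ x) a * (δ (h₂ y) b * P x y)) ⟩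
    ∑[ x < m ] ∑[ y < k ] ∑[ a < A ] (δ (h₁ x) a * (δ (h₂ y) b * P x y))
      ≡⟨ sum-cong-≗ (λ x → sum-cong-≗ λ y → ∑-δ-* (h₁ x) (const (δ (h₂ y) b * P x y))) ⟩
    ∑[ x < m ] ∑[ y < k ] (δ (h₂ y) b * P x y)
      ≡⟨ ∑-comm (λ x y → δ (h₂ y) b * P x y) ⟩
    ∑[ y < k ] ∑[ x < m ] (δ (h₂ y) b * P x y)
      ≡⟨ sum-cong-≗ (λ y → *-distribˡ-sum (δ (h₂ y) b) (λ x → P x y)) ⟨
    ∑[ y < k ] (δ (h₂ y) b * colSum P y) ∎
    where open ≡-Reasoning

  bucket-centre : ∀ (P : Fin m → Fin k → ℚ) a b → bucket h₁ h₂ (centre P) a b ≡ centre (bucket h₁ h₂ P) a b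
  bucket-centre P a b = begin
    bucket h₁ h₂ (centre P) a b
      ≡⟨ bucket-minus P (λ x y → rowSum P x * colSum P y) a b ⟩
    bucket h₁ h₂ P a b - bucket h₁ h₂ (λ x y → rowSum P x * colSum P y) a b
      ≡⟨ cong (λ t → bucket h₁ h₂ P a b - t) (bucket-outer (rowSum P) (colSum P) a b) ⟩
    bucket h₁ h₂ P a b - ∑[ x < m ] (δ (h₁ x) a * rowSum P x) * ∑[ y < k ] (δ (h₂ y) b * colSum P y)
      ≡⟨ cong₂ (λ r s → bucket h₁ h₂ P a b - r * s) (rowSum-bucket P a) (colSum-bucket P b) ⟨
    centre (bucket h₁ h₂ P) a b ∎
    where open ≡-Reasoning

  bucket-as-bucketCols : ∀ (P : Fin m → Fin k → ℚ) a b → bucket h₁ h₂ P a b ≡ bucketCols h₂ (bucketRows h₁ P) a b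
  bucket-as-bucketCols P a b = begin
    ∑[ x < m ] ∑[ y < k ] (δ (h₁ x) a * (δ (h₂ y) b * P x y))
      ≡⟨ ∑-comm (λ x y → δ (h₁ x) a * (δ (h₂ y) b * P x y)) ⟩
    ∑[ y < k ] ∑[ x < m ] (δ (h₁ x) a * (δ (h₂ y) b * P x y))
      ≡⟨ sum-cong-≗ (λ y → trans (sum-cong-≗ λ x → swap (δ (h₁ x) a) (δ (h₂ y) b) (P x y))
                                 (sym (*-distribˡ-sum (δ (h₂ y) b) (λ x → δ (h₁ x) a * P x y)))) ⟩
    ∑[ y < k ] (δ (h₂ y) b * ∑[ x < m ] (δ (h₁ x) a * P x y)) ∎
    where
    open ≡-Reasoning
    swap : ∀ d e p → d * (e * p) ≡ e * (d * p)
    swap = solve-∀ ℚ-ring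

centre-cong : ∀ {m k} {P Q : Fin m → Fin k → ℚ} → (∀ i j → P i j ≡ Q i j) → ∀ i j → centre P i j ≡ centre Q i j
centre-cong P≗Q i j = cong₂ (λ p q → p - q) (P≗Q i j)
  (cong₂ _*_ (sum-cong-≗ (P≗Q i)) (sum-cong-≗ (λ i′ → P≗Q i′ j)))

bucketRows-rows : ∀ {n k A} (h : Fin n → Fin A) (M : Fin n → Fin k → ℚ) →
                    (∀ x → rowSum M x ≡ 0ℚ) → ∀ a → rowSum (bucketRows h M) a ≡ 0ℚ
bucketRows-rows {n} {k} h M rows a = begin
  ∑[ j < k ] ∑[ x < n ] (δ (h x) a * M x j)   ≡⟨ ∑-comm (λ j x → δ (h x) a * M x j) ⟩
  ∑[ x < n ] ∑[ j < k ] (δ (h x) a * M x j)   ≡⟨ sum-cong-≗ (λ x → *-distribˡ-sum (δ (h x) a) (M x)) ⟨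
  ∑[ x < n ] (δ (h x) a * rowSum M x)         ≡⟨ sum-cong-≗ (λ x → trans (cong (δ (h x) a *_) (rows x)) (*-zeroʳ (δ (h x) a))) ⟩
  ∑[ x < n ] 0ℚ                               ≡⟨ sum-replicate-zero n ⟩
  0ℚ                                          ∎
  where open ≡-Reasoning

freq : ∀ {m k} → ℕ → (Fin m → Fin k → ℕ) → Fin m → Fin k → ℚ
freq N Q i j = Q i j /ℕ N

∑-/ℕ : ∀ {k} N .{{_ : NonZero N}} (f : Fin k → ℕ) → ∑[ j < k ] (f j /ℕ N) ≡ Σℕ k f /ℕ N
∑-/ℕ {k} N f = begin
  ∑[ j < k ] (f j /ℕ N)                 ≡⟨ sum-cong-≗ (λ j → /ℕ-as-* (f j) N) ⟩
  ∑[ j < k ] (fromℕ (f j) * (1 /ℕ N))   ≡⟨ *-distribʳ-sum (1 /ℕ N) (fromℕ ∘ f) ⟨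
  ∑[ j < k ] fromℕ (f j) * (1 /ℕ N)     ≡⟨ cong (_* 1 /ℕ N) (fromℕ-Σℕ k f) ⟨
  fromℕ (Σℕ k f) * (1 /ℕ N)             ≡⟨ /ℕ-as-* (Σℕ k f) N ⟨
  Σℕ k f /ℕ N                           ∎
  where open ≡-Reasoning

centre-freq : ∀ {m k} N .{{_ : NonZero N}} (Q : Fin m → Fin k → ℕ) i j →
  centre (freq N Q) i j ≡ Q i j /ℕ N - (Σℕ k (Q i) /ℕ N) * (Σℕ m (λ i′ → Q i′ j) /ℕ N)
centre-freq N Q i j = cong₂ (λ r s → Q i j /ℕ N - r * s) (∑-/ℕ N (Q i)) (∑-/ℕ N (λ i′ → Q i′ j))

fromℕ-if-if : ∀ p q k → fromℕ (if p then (if q then k else 0) else 0)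
              ≡ (if p then 1ℚ else 0ℚ) * ((if q then 1ℚ else 0ℚ) * fromℕ k)
fromℕ-if-if true  true  k = sym (trans (*-identityˡ _) (*-identityˡ (fromℕ k)))
fromℕ-if-if true  false k = sym (trans (*-identityˡ _) (*-zeroˡ (fromℕ k)))
fromℕ-if-if false q     k = sym (*-zeroˡ ((if q then 1ℚ else 0ℚ) * fromℕ k))

module _ {n : ℕ} (c : Counts n) .{{_ : NonZero (total n c)}} where

  private
    N : ℕ
    N = total n c

  freq-total : ∑[ x < n ] rowSum (freq N c) x ≡ 1ℚ
  freq-total = begin
    ∑[ x < n ] ∑[ y < n ] (c x y /ℕ N)      ≡⟨ sum-cong-≗ (λ x → ∑-/ℕ N (c x)) ⟩
    ∑[ x < n ] (Σℕ n (c x) /ℕ N)            ≡⟨ ∑-/ℕ N (λ x → Σℕ n (c x)) ⟩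
    N /ℕ N                                  ≡⟨ /ℕ-as-* N N ⟩
    fromℕ N * (1 /ℕ N)                      ≡⟨ fromℕ-*-1/ℕ N ⟩
    1ℚ                                      ∎
    where open ≡-Reasoning

  freq-Cmat : ∀ {A} (h₁ h₂ : Fin n → Fin A) a b → freq N (Cmat n A c h₁ h₂) a b ≡ bucket h₁ h₂ (freq N c) a b
  freq-Cmat h₁ h₂ a b = begin
    Cmat _ _ c h₁ h₂ a b /ℕ N
      ≡⟨ /ℕ-as-* _ N ⟩
    fromℕ (Cmat _ _ c h₁ h₂ a b) * r
      ≡⟨ cong (_* r) (trans (fromℕ-Σℕ n _) (sum-cong-≗ λ x → trans (fromℕ-Σℕ n _) (sum-cong-≗ λ y →
           fromℕ-if-if ⌊ h₁ x Fin.≟ a ⌋ ⌊ h₂ y Fin.≟ b ⌋ (c x y)))) ⟩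
    ∑[ x < n ] ∑[ y < n ] (δ (h₁ x) a * (δ (h₂ y) b * fromℕ (c x y))) * r
      ≡⟨ trans (*-distribʳ-sum r (λ x → ∑[ y < n ] (δ (h₁ x) a * (δ (h₂ y) b * fromℕ (c x y)))))
               (sum-cong-≗ λ x → *-distribʳ-sum r (λ y → δ (h₁ x) a * (δ (h₂ y) b * fromℕ (c x y)))) ⟩
    ∑[ x < n ] ∑[ y < n ] (δ (h₁ x) a * (δ (h₂ y) b * fromℕ (c x y)) * r)
      ≡⟨ sum-cong-≗ (λ x → sum-cong-≗ λ y → trans (reassoc (δ (h₁ x) a) (δ (h₂ y) b) (fromℕ (c x y)) r)
           (cong (λ q → δ (h₁ x) a * (δ (h₂ y) b * q)) (sym (/ℕ-as-* (c x y) N)))) ⟩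
    bucket h₁ h₂ (freq N c) a b ∎
    where
    open ≡-Reasoning
    r : ℚ
    r = 1 /ℕ N
    reassoc : ∀ d e k r → d * (e * k) * r ≡ d * (e * (k * r))
    reassoc = solve-∀ ℚ-ring

  normSqΔhat≡ : normSqΔhat n c ≡ ‖ centre (freq N c) ‖²
  normSqΔhat≡ = trans (Σℚ≡∑ n _) (sum-cong-≗ λ x → trans (Σℚ≡∑ n _) (sum-cong-≗ λ y →
    cong (λ t → t * t) (sym (centre-freq N c x y))))

  normSqΔtilde≡ : ∀ {A} (h₁ h₂ : Fin n → Fin A) →
                  normSqΔtilde n A c h₁ h₂ ≡ ‖ bucketCols h₂ (bucketRows h₁ (centre (freq N c))) ‖²
  normSqΔtilde≡ {A} h₁ h₂ = trans (Σℚ≡∑ A _) (sum-cong-≗ λ a → trans (Σℚ≡∑ A _) (sum-cong-≗ λ b →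
    cong (λ t → t * t) (Δtilde≡ a b)))
    where
    open ≡-Reasoning
    C = Cmat n A c h₁ h₂
    Δtilde≡ : ∀ a b → Δtilde n A c h₁ h₂ a b ≡ bucketCols h₂ (bucketRows h₁ (centre (freq N c))) a b
    Δtilde≡ a b = begin
      C a b /ℕ N - (Σℕ A (C a) ℕ.* Σℕ A (λ a′ → C a′ b)) /ℕ (N ℕ.* N)
        ≡⟨ cong (λ t → C a b /ℕ N - t) (/ℕ-*-/ℕ (Σℕ A (C a)) (Σℕ A (λ a′ → C a′ b)) N) ⟩
      C a b /ℕ N - (Σℕ A (C a) /ℕ N) * (Σℕ A (λ a′ → C a′ b) /ℕ N)
        ≡⟨ centre-freq N C a b ⟨
      centre (freq N C) a b
        ≡⟨ centre-cong (freq-Cmat h₁ h₂) a b ⟩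
      centre (bucket h₁ h₂ (freq N c)) a b
        ≡⟨ bucket-centre h₁ h₂ (freq N c) a b ⟨
      bucket h₁ h₂ (centre (freq N c)) a b
        ≡⟨ bucket-as-bucketCols h₁ h₂ (centre (freq N c)) a b ⟩
      bucketCols h₂ (bucketRows h₁ (centre (freq N c))) a b ∎

-- Bucketing the rows and columns of a centred matrix

module _ {n A : ℕ} .{{_ : NonZero A}} (D : Fin n → Fin n → ℚ)
         (rows : ∀ x → rowSum D x ≡ 0ℚ) (cols : ∀ y → colSum D y ≡ 0ℚ) where

  private
    u : ℚ
    u = 1 /ℕ A

  ‖bucketRows‖² : ∀ (h : Fin n → Fin A) → ‖ bucketRows h D ‖² ≡ ‖ bucketCols h (flip D) ‖²
  ‖bucketRows‖² h = ‖flip‖² (bucketCols h (flip D))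

  𝔼𝔼-‖bucket‖² : 𝔼 (λ h₁ → 𝔼 (λ h₂ → ‖ bucketCols h₂ (bucketRows h₁ D) ‖²)) ≡ (1ℚ - u) * ((1ℚ - u) * ‖ D ‖²)
  𝔼𝔼-‖bucket‖² = begin
    𝔼 (λ h₁ → 𝔼 (λ h₂ → ‖ bucketCols h₂ (bucketRows h₁ D) ‖²))
      ≡⟨ 𝔼-cong (λ h₁ → trans (𝔼-‖bucketCols‖² (bucketRows h₁ D) (bucketRows-rows h₁ D rows))
                              (cong ((1ℚ - u) *_) (‖bucketRows‖² h₁))) ⟩
    𝔼 (λ h₁ → (1ℚ - u) * ‖ bucketCols h₁ (flip D) ‖²)
      ≡⟨ 𝔼-*ˡ (1ℚ - u) (λ h₁ → ‖ bucketCols h₁ (flip D) ‖²) ⟩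
    (1ℚ - u) * 𝔼 (λ h₁ → ‖ bucketCols h₁ (flip D) ‖²)
      ≡⟨ cong ((1ℚ - u) *_) (trans (𝔼-‖bucketCols‖² (flip D) cols) (cong ((1ℚ - u) *_) (‖flip‖² D))) ⟩
    (1ℚ - u) * ((1ℚ - u) * ‖ D ‖²) ∎
    where open ≡-Reasoning

  𝔼𝔼-‖bucket‖⁴ : 𝔼 (λ h₁ → 𝔼 (λ h₂ → ‖ bucketCols h₂ (bucketRows h₁ D) ‖² * ‖ bucketCols h₂ (bucketRows h₁ D) ‖²))
                   ≤ℚ (1ℚ - u * u) * ((1ℚ - u * u) * (‖ D ‖² * ‖ D ‖²))
  𝔼𝔼-‖bucket‖⁴ = begin
    𝔼 (λ h₁ → 𝔼 (λ h₂ → ‖ bucketCols h₂ (bucketRows h₁ D) ‖² * ‖ bucketCols h₂ (bucketRows h₁ D) ‖²))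
      ≤⟨ 𝔼-mono-≤ (λ h₁ → 𝔼-‖bucketCols‖⁴ (bucketRows h₁ D) (bucketRows-rows h₁ D rows)) ⟩
    𝔼 (λ h₁ → (1ℚ - u * u) * (‖ bucketRows h₁ D ‖² * ‖ bucketRows h₁ D ‖²))
      ≡⟨ trans (𝔼-*ˡ (1ℚ - u * u) (λ h₁ → ‖ bucketRows h₁ D ‖² * ‖ bucketRows h₁ D ‖²))
               (cong ((1ℚ - u * u) *_) (𝔼-cong (λ h₁ → cong (λ t → t * t) (‖bucketRows‖² h₁)))) ⟩
    (1ℚ - u * u) * 𝔼 (λ h₁ → ‖ bucketCols h₁ (flip D) ‖² * ‖ bucketCols h₁ (flip D) ‖²)
      ≤⟨ *-monoˡ-≤ 0≤1-u² (𝔼-‖bucketCols‖⁴ (flip D) cols) ⟩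
    (1ℚ - u * u) * ((1ℚ - u * u) * (‖ flip D ‖² * ‖ flip D ‖²))
      ≡⟨ cong (λ t → (1ℚ - u * u) * ((1ℚ - u * u) * (t * t))) (‖flip‖² D) ⟩
    (1ℚ - u * u) * ((1ℚ - u * u) * (‖ D ‖² * ‖ D ‖²)) ∎
    where
    open ≤-Reasoning
    factor : ∀ u → (1ℚ - u) + u * (1ℚ - u) ≡ 1ℚ - u * u
    factor = solve-∀ ℚ-ring
    0≤1-u² : 0ℚ ≤ℚ 1ℚ - u * u
    0≤1-u² = subst (0ℚ ≤ℚ_) (factor u) (0≤+ (0≤1-1/ℕ A) (0≤* (0≤1/ℕ A) (0≤1-1/ℕ A)))

variance-bound : ∀ u F → 0ℚ ≤ℚ u → 0ℚ ≤ℚ 1ℚ - u →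
  (1ℚ - u * u) * ((1ℚ - u * u) * (F * F)) - ((1ℚ - u) * ((1ℚ - u) * F)) * ((1ℚ - u) * ((1ℚ - u) * F))
  ≤ℚ fromℕ 8 * u * (F * F)
variance-bound u F 0≤u 0≤1-u = 0≤q-p⇒p≤q (subst (0ℚ ≤ℚ_) (slack u F)
  (0≤* (0≤* (0≤fromℕ 4) 0≤u) (0≤* (0≤+ (0≤fromℕ 1) (0≤+ 0≤u (0≤* 0≤u 0≤1-u))) (0≤*-self F))))
  where
  slack : ∀ u F → fromℕ 4 * u * ((1ℚ + (u + u * (1ℚ - u))) * (F * F))
    ≡ fromℕ 8 * u * (F * F) - ((1ℚ - u * u) * ((1ℚ - u * u) * (F * F))
                               - ((1ℚ - u) * ((1ℚ - u) * F)) * ((1ℚ - u) * ((1ℚ - u) * F)))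
  slack = solve-∀ ℚ-ring

module _ {n A : ℕ} .{{_ : NonZero A}} (c : Counts n) .{{_ : NonZero (total n c)}} where

  private
    u : ℚ
    u = 1 /ℕ A
    P = freq (total n c) c
    D-rows = centre-rows P (freq-total c)
    D-cols = centre-cols P (freq-total c)

  E₂-normSqΔtilde : E₂ n A (normSqΔtilde n A c) ≡ (1ℚ - u) * ((1ℚ - u) * normSqΔhat n c)
  E₂-normSqΔtilde = begin
    E₂ n A (normSqΔtilde n A c)
      ≡⟨ E₂≡𝔼𝔼 (normSqΔtilde n A c) ⟩
    𝔼 (λ h₁ → 𝔼 (λ h₂ → normSqΔtilde n A c h₁ h₂))
      ≡⟨ 𝔼-cong (λ h₁ → 𝔼-cong (λ h₂ → normSqΔtilde≡ c h₁ h₂)) ⟩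
    𝔼 (λ h₁ → 𝔼 (λ h₂ → ‖ bucketCols h₂ (bucketRows h₁ (centre P)) ‖²))
      ≡⟨ 𝔼𝔼-‖bucket‖² (centre P) D-rows D-cols ⟩
    (1ℚ - u) * ((1ℚ - u) * ‖ centre P ‖²)
      ≡⟨ cong (λ F → (1ℚ - u) * ((1ℚ - u) * F)) (normSqΔhat≡ c) ⟨
    (1ℚ - u) * ((1ℚ - u) * normSqΔhat n c) ∎
    where open ≡-Reasoning

  E₂-normSqΔtilde² : E₂ n A (λ h₁ h₂ → normSqΔtilde n A c h₁ h₂ * normSqΔtilde n A c h₁ h₂)
                     ≤ℚ (1ℚ - u * u) * ((1ℚ - u * u) * (normSqΔhat n c * normSqΔhat n c))
  E₂-normSqΔtilde² = begin
    E₂ n A (λ h₁ h₂ → normSqΔtilde n A c h₁ h₂ * normSqΔtilde n A c h₁ h₂)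
      ≡⟨ E₂≡𝔼𝔼 (λ h₁ h₂ → normSqΔtilde n A c h₁ h₂ * normSqΔtilde n A c h₁ h₂) ⟩
    𝔼 (λ h₁ → 𝔼 (λ h₂ → normSqΔtilde n A c h₁ h₂ * normSqΔtilde n A c h₁ h₂))
      ≡⟨ 𝔼-cong (λ h₁ → 𝔼-cong (λ h₂ → cong (λ t → t * t) (normSqΔtilde≡ c h₁ h₂))) ⟩
    𝔼 (λ h₁ → 𝔼 (λ h₂ → ‖ bucketCols h₂ (bucketRows h₁ (centre P)) ‖² * ‖ bucketCols h₂ (bucketRows h₁ (centre P)) ‖²))
      ≤⟨ 𝔼𝔼-‖bucket‖⁴ (centre P) D-rows D-cols ⟩
    (1ℚ - u * u) * ((1ℚ - u * u) * (‖ centre P ‖² * ‖ centre P ‖²))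
      ≡⟨ cong (λ F → (1ℚ - u * u) * ((1ℚ - u * u) * (F * F))) (normSqΔhat≡ c) ⟨
    (1ℚ - u * u) * ((1ℚ - u * u) * (normSqΔhat n c * normSqΔhat n c)) ∎
    where open ≤-Reasoning

lemma6 : (n A : ℕ) → 1 ≤ n → 1 ≤ A → (c : Counts n) → 0 < total n c →
    Var₂ n A (normSqΔtilde n A c)
      ≤ℚ ((8 /ℕ A) * (normSqΔhat n c * normSqΔhat n c))
lemma6 n A _ 1≤A c N>0 = begin
  E₂ n A (λ h₁ h₂ → Y h₁ h₂ * Y h₁ h₂) - E₂ n A Y * E₂ n A Y
    ≤⟨ +-monoˡ-≤ (- (E₂ n A Y * E₂ n A Y)) (E₂-normSqΔtilde² c) ⟩
  (1ℚ - u * u) * ((1ℚ - u * u) * (F * F)) - E₂ n A Y * E₂ n A Y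
    ≡⟨ cong (λ e → (1ℚ - u * u) * ((1ℚ - u * u) * (F * F)) - e * e) (E₂-normSqΔtilde c) ⟩
  (1ℚ - u * u) * ((1ℚ - u * u) * (F * F)) - ((1ℚ - u) * ((1ℚ - u) * F)) * ((1ℚ - u) * ((1ℚ - u) * F))
    ≤⟨ variance-bound u F (0≤1/ℕ A) (0≤1-1/ℕ A) ⟩
  fromℕ 8 * u * (F * F)
    ≡⟨ cong (_* (F * F)) (/ℕ-as-* 8 A) ⟨
  (8 /ℕ A) * (F * F) ∎
  where
  open ≤-Reasoning
  instance
    A≢0 : NonZero A
    A≢0 = ℕ.>-nonZero 1≤A
    N≢0 : NonZero (total n c)
    N≢0 = ℕ.>-nonZero N>0
  u = 1 /ℕ A
  F = normSqΔhat n c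
  Y = normSqΔtilde n A c
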